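{- Let $G$ be either (i) a Johnson graph $J(n,e)$ with $n\ge 2e\ge 2$, whose vertices are the $e$-subsets of $\{1,\dots,n\}$, two being adjacent iff they intersect in $e-1$ elements; or (ii) a Hamming graph $H(d,q)$ with $d\ge1$, $q\ge2$, whose vertices are the elements of $\{1,\dots,q\}^d$, two being adjacent iff they differ in exactly one coordinate. Let $k$ be the valency, $\theta_1$ the second largest distinct adjacency eigenvalue and $\lambda_1=(k-\theta_1)/k$ the smallest positive normalized Laplacian eigenvalue. Then $h_G\le\lambda_1$.
   Context: For $A,B\subseteq V(G)$, $E[A,B]$ is the number of ordered pairs $(x,y)$ with $x\in A$, $y\in B$, $x\sim y$; $\mathrm{vol}(S)=\sum_{x\in S}\deg(x)$; $S^c=V(G)\setminus S$. The Cheeger constant is $h_G=\min\{E[S,S^c]/\mathrm{vol}(S):\emptyset\ne S\subseteq V(G),\ |S|\le|V(G)|/2\}$. -}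

module Defs where

open import Data.Bool using (Bool; true; false; if_then_else_; _∧_; not)
open import Data.Nat using (ℕ; zero; suc; _∸_; _≡ᵇ_)
import Data.Nat as ℕ
open import Data.Fin using (Fin)
open import Data.Fin.Subset using (Subset; ∣_∣; _∩_)
open import Data.Vec using (Vec; []; _∷_; lookup)
open import Data.List using (List; []; _∷_; [_]; map; concatMap; filter; length; allFin; foldr)
open import Data.List.Membership.Propositional using (_∈_)
open import Data.Integer using (+_)
open import Data.Rational using (ℚ; _/_; _-_; _*_; _≤_; 0ℚ)
import Data.Rational as ℚ
open import Data.Product using (Σ; ∃; _×_; _,_)
open import Relation.Binary.PropositionalEquality using (_≡_; _≢_)
open import Relation.Nullary using (does)
import Data.Fin as Fin

-- A finite (simple) graph given by an explicit duplicate-free enumeration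
-- of its vertex set and a Boolean adjacency relation.
record Graph : Set₁ where
  field
    V     : Set
    verts : List V
    adj   : V → V → Bool
open Graph public

countL : {A : Set} → (A → Bool) → List A → ℕ
countL p []       = 0
countL p (x ∷ xs) = if p x then suc (countL p xs) else countL p xs

sumℚ : {A : Set} → (A → ℚ) → List A → ℚ
sumℚ f = foldr (λ x acc → f x ℚ.+ acc) 0ℚ

-- a / b as a rational, with the (never used here) convention a / 0 = 0
frac : ℕ → ℕ → ℚ
frac a zero    = 0ℚ
frac a (suc b) = (+ a) / suc b

module _ (G : Graph) where

  deg : V G → ℕ
  deg x = countL (adj G x) (verts G)

  -- subsets of V(G) are Boolean predicates on vertices
  card : (V G → Bool) → ℕ
  card S = countL S (verts G)

  vol : (V G → Bool) → ℕ
  vol S = foldr (λ x acc → (if S x then deg x else 0) ℕ.+ acc) 0 (verts G)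

  edgeBoundary : (V G → Bool) → ℕ
  edgeBoundary S =
    foldr (λ x acc → (if S x then countL (λ y → not (S y) ∧ adj G x y) (verts G) else 0) ℕ.+ acc)
          0 (verts G)

  cheegerRatio : (V G → Bool) → ℚ
  cheegerRatio S = frac (edgeBoundary S) (vol S)

  Admissible : (V G → Bool) → Set
  Admissible S = (∃ λ x → x ∈ verts G × S x ≡ true) × (2 ℕ.* card S ℕ.≤ length (verts G))

  IsCheegerConstant : ℚ → Set
  IsCheegerConstant h =
    (Σ (V G → Bool) λ S → Admissible S × cheegerRatio S ≡ h)
    × (∀ S → Admissible S → h ≤ cheegerRatio S)

  Regular : ℕ → Set
  Regular k = ∀ x → x ∈ verts G → deg x ≡ k

  AdjEigenvalue : ℚ → Set
  AdjEigenvalue θ = Σ (V G → ℚ) λ f →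
    (∃ λ x → x ∈ verts G × f x ≢ 0ℚ)
    × (∀ x → x ∈ verts G →
         sumℚ (λ y → if adj G x y then f y else 0ℚ) (verts G) ≡ θ * f x)

  SecondLargestEigenvalue : ℚ → Set
  SecondLargestEigenvalue θ₁ = Σ ℚ λ θ₀ →
    AdjEigenvalue θ₀ × AdjEigenvalue θ₁ × θ₁ ℚ.< θ₀
    × (∀ μ → AdjEigenvalue μ → μ ≤ θ₀)
    × (∀ μ → AdjEigenvalue μ → θ₁ ℚ.< μ → μ ≡ θ₀)

lambda1 : ℚ → ℕ → ℚ
lambda1 θ zero    = 0ℚ
lambda1 θ (suc k) = ((+ suc k) / 1 - θ) * ((+ 1) / suc k)

allVecs : {A : Set} → List A → (m : ℕ) → List (Vec A m)
allVecs xs zero    = [ [] ]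
allVecs xs (suc m) = concatMap (λ a → map (a ∷_) (allVecs xs m)) xs

johnson : ℕ → ℕ → Graph
johnson n e = record
  { V     = Subset n
  ; verts = filter (λ p → ∣ p ∣ ℕ.≟ e) (allVecs (true ∷ false ∷ []) n)
  ; adj   = λ p q → ∣ p ∩ q ∣ ≡ᵇ (e ∸ 1)
  }

hammingDist : {q d : ℕ} → Vec (Fin q) d → Vec (Fin q) d → ℕ
hammingDist [] [] = 0
hammingDist (a ∷ u) (b ∷ v) = (if does (a Fin.≟ b) then 0 else 1) ℕ.+ hammingDist u v

hamming : ℕ → ℕ → Graph
hamming d q = record
  { V     = Vec (Fin q) d
  ; verts = allVecs (allFin q) d
  ; adj   = λ u v → hammingDist u v ≡ᵇ 1
  }

-- Two facts about each graph G give the result: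
--  (spectral gap) every adjacency eigenvalue is the valency K or at most K - g,
--    where g = n for J(n,e) and g = q for H(d,q); as θ₁ < θ₀ are both
--    eigenvalues, θ₁ ≠ K, hence θ₁ ≤ K - g.
--  (test set) the e-sets containing a fixed point, resp. the words with a fixed
--    first letter, form an admissible S with E[S,Sᶜ] = |S|·a, vol S = |S|·K and
--    a ≤ g (a = n - e, resp. q - 1); so h ≤ a/K ≤ g/K ≤ λ₁.
-- The gaps are proved by induction with exact eigenvector bookkeeping over ℚ:
-- summing an eigenvector of H(d+1,q) over the first letter, or of J(n,m+1)
-- over supersets (the "down" operator), yields an eigenvector one level lower
-- with shifted eigenvalue; when that sum vanishes, a slice (Hamming) or the
-- identity up ∘ down = A + m (Johnson) pins the eigenvalue down directly.
module Submission where

open import Data.Bool using (Bool; true; false; if_then_else_; _∧_; _∨_; not; T)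
open import Data.Bool.Properties using (∧-zeroʳ)
open import Data.Empty using (⊥; ⊥-elim)
open import Data.Fin as Fin using (Fin)
open import Data.Fin.Subset using (Subset; ∣_∣; _∩_; _∪_; ∁; ⊤)
open import Data.Fin.Subset.Properties using (∩-idem; ∪-idem; ∣p∩q∣≤∣p∣; ∣p∩q∣≤∣q∣; ∣p∣≤n; ∣⊤∣≡n; ∣∁p∣≡n∸∣p∣)
open import Data.Integer as ℤ using (ℤ)
import Data.Integer.Properties as ℤP
open import Data.Integer.Tactic.RingSolver using (solve-∀)
open import Data.List using (List; []; _∷_; _++_; map; concatMap; filter; foldr; length; allFin; tabulate)
open import Data.List.Membership.Propositional using (_∈_; lose)
open import Data.List.Membership.Propositional.Properties using (∈-allFin; ∈-filter⁻; ∈-filter⁺; ∈-map⁺; ∈-concatMap⁺)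
open import Data.List.Relation.Unary.Any using (here; there)
open import Data.Nat using (ℕ; zero; suc; _≡ᵇ_)
import Data.Nat as ℕ
import Data.Nat.Properties as ℕP
open import Data.Product using (Σ; ∃; _×_; _,_; proj₁; proj₂)
open import Data.Rational using (ℚ; 0ℚ; 1ℚ; _+_; _*_; _-_; -_; _≤_; _<_; Positive; NonNegative; positive; nonNegative; ≢-nonZero; 1/_; _/_; toℚᵘ)
open import Data.Rational.Properties
open import Data.Rational.Solver using (module +-*-Solver)
open import Data.Rational.Unnormalised as U using (mkℚᵘ; *≡*)
import Data.Rational.Unnormalised.Properties as UP
open import Data.Sum using (_⊎_; inj₁; inj₂)
open import Data.Unit using (tt)
open import Data.Vec using (Vec; []; _∷_; replicate)
open import Relation.Binary.PropositionalEquality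
open import Relation.Nullary using (does; yes; no)
open import Relation.Unary using (Decidable)
open import Defs

open +-*-Solver

private variable
  A B : Set

-- ι n is the natural number n as a rational; all counting is transported
-- along ι, a semiring embedding that preserves and reflects the order.
ι : ℕ → ℚ
ι zero = 0ℚ
ι (suc n) = 1ℚ + ι n

ι-+ : ∀ a b → ι (a ℕ.+ b) ≡ ι a + ι b
ι-+ zero b = sym (+-identityˡ (ι b))
ι-+ (suc a) b = trans (cong (1ℚ +_) (ι-+ a b)) (sym (+-assoc 1ℚ (ι a) (ι b)))

ι-* : ∀ a b → ι (a ℕ.* b) ≡ ι a * ι b
ι-* zero b = sym (*-zeroˡ (ι b))
ι-* (suc a) b = trans (ι-+ b (a ℕ.* b)) (trans (cong (ι b +_) (ι-* a b))
   (solve 2 (λ x y → y :+ x :* y := (con 1ℚ :+ x) :* y) refl (ι a) (ι b)))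

ι-nonneg : ∀ n → 0ℚ ≤ ι n
ι-nonneg zero = ≤-refl
ι-nonneg (suc n) = subst (_≤ 1ℚ + ι n) (+-identityˡ 0ℚ) (+-mono-≤ (<⇒≤ (positive⁻¹ 1ℚ)) (ι-nonneg n))

ι-pos : ∀ n → 0ℚ < ι (suc n)
ι-pos n = subst (_< 1ℚ + ι n) (+-identityˡ 0ℚ) (+-mono-<-≤ (positive⁻¹ 1ℚ) (ι-nonneg n))

≤-+-nonneg : ∀ p r → 0ℚ ≤ r → p ≤ p + r
≤-+-nonneg p r h = subst (_≤ p + r) (+-identityʳ p) (+-monoʳ-≤ p h)

ι-mono : ∀ {a b} → a ℕ.≤ b → ι a ≤ ι b
ι-mono {a} h with ℕP.m≤n⇒∃[o]m+o≡n h
... | o , refl = subst (ι a ≤_) (sym (ι-+ a o)) (≤-+-nonneg (ι a) (ι o) (ι-nonneg o))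

ι-reflect : ∀ {a b} → ι a ≤ ι b → a ℕ.≤ b
ι-reflect {a} {b} h with ℕP.≤-total a b
... | inj₁ p = p
... | inj₂ p with ℕP.m≤n⇒∃[o]m+o≡n p
...   | zero , refl = ℕP.≤-reflexive (ℕP.+-identityʳ b)
...   | suc o , refl = ⊥-elim (<-irrefl refl (≤-<-trans h
          (subst (_< ι (b ℕ.+ suc o)) (+-identityʳ (ι b)) (subst (ι b + 0ℚ <_) (sym (ι-+ b (suc o))) (+-monoʳ-< (ι b) (ι-pos o))))))

cancel-≢0 : ∀ x c → x * c ≡ 0ℚ → c ≢ 0ℚ → x ≡ 0ℚ
cancel-≢0 x c e nz = begin
    x                 ≡⟨ sym (*-identityʳ x) ⟩
    x * 1ℚ            ≡⟨ cong (x *_) (sym (*-inverseʳ c)) ⟩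
    x * (c * (1/ c))  ≡⟨ sym (*-assoc x c (1/ c)) ⟩
    (x * c) * (1/ c)  ≡⟨ cong (_* (1/ c)) e ⟩
    0ℚ * (1/ c)       ≡⟨ *-zeroˡ (1/ c) ⟩
    0ℚ ∎
  where
  open ≡-Reasoning
  instance _ = ≢-nonZero nz

allVecs-complete : (xs : List A) → (∀ a → a ∈ xs) → ∀ d (u : Vec A d) → u ∈ allVecs xs d
allVecs-complete xs all-in zero [] = here refl
allVecs-complete xs all-in (suc d) (a ∷ u) =
  ∈-concatMap⁺ (λ b → map (b ∷_) (allVecs xs d)) (lose (all-in a) (∈-map⁺ (a ∷_) (allVecs-complete xs all-in d u)))

sum-cong : {F G : A → ℚ} (xs : List A) → (∀ x → x ∈ xs → F x ≡ G x) → sumℚ F xs ≡ sumℚ G xs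
sum-cong [] h = refl
sum-cong (x ∷ xs) h = cong₂ _+_ (h x (here refl)) (sum-cong xs (λ y m → h y (there m)))

sum-0 : (xs : List A) → sumℚ (λ _ → 0ℚ) xs ≡ 0ℚ
sum-0 [] = refl
sum-0 (x ∷ xs) = trans (+-identityˡ _) (sum-0 xs)

sum-zero : (xs : List A) (F : A → ℚ) → (∀ x → F x ≡ 0ℚ) → sumℚ F xs ≡ 0ℚ
sum-zero xs F h = trans (sum-cong xs (λ x _ → h x)) (sum-0 xs)

sum-++ : (F : A → ℚ) (xs ys : List A) → sumℚ F (xs ++ ys) ≡ sumℚ F xs + sumℚ F ys
sum-++ F [] ys = sym (+-identityˡ _)
sum-++ F (x ∷ xs) ys = trans (cong (F x +_) (sum-++ F xs ys)) (sym (+-assoc (F x) _ _))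

sum-+ : (F G : A → ℚ) (xs : List A) → sumℚ (λ x → F x + G x) xs ≡ sumℚ F xs + sumℚ G xs
sum-+ F G [] = sym (+-identityˡ 0ℚ)
sum-+ F G (x ∷ xs) = trans (cong (F x + G x +_) (sum-+ F G xs))
    (solve 4 (λ a b c d → (a :+ b) :+ (c :+ d) := (a :+ c) :+ (b :+ d)) refl (F x) (G x) (sumℚ F xs) (sumℚ G xs))

sum-* : (c : ℚ) (F : A → ℚ) (xs : List A) → sumℚ (λ x → c * F x) xs ≡ c * sumℚ F xs
sum-* c F [] = sym (*-zeroʳ c)
sum-* c F (x ∷ xs) = trans (cong (c * F x +_) (sum-* c F xs)) (sym (*-distribˡ-+ c (F x) _))

sum-filter : {P : A → Set} (P? : Decidable P) (F : A → ℚ) (xs : List A) →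
   sumℚ F (filter P? xs) ≡ sumℚ (λ x → if does (P? x) then F x else 0ℚ) xs
sum-filter P? F [] = refl
sum-filter P? F (x ∷ xs) with does (P? x)
... | true = cong (F x +_) (sum-filter P? F xs)
... | false = trans (sum-filter P? F xs) (sym (+-identityˡ _))

sum-map : (g : B → A) (F : A → ℚ) (ys : List B) → sumℚ F (map g ys) ≡ sumℚ (λ y → F (g y)) ys
sum-map g F [] = refl
sum-map g F (y ∷ ys) = cong (F (g y) +_) (sum-map g F ys)

sum-concatMap : (g : B → List A) (F : A → ℚ) (ys : List B) →
   sumℚ F (concatMap g ys) ≡ sumℚ (λ y → sumℚ F (g y)) ys
sum-concatMap g F [] = refl
sum-concatMap g F (y ∷ ys) = trans (sum-++ F (g y) (concatMap g ys)) (cong (sumℚ F (g y) +_) (sum-concatMap g F ys))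

sum-swap : (F : A → B → ℚ) (xs : List A) (ys : List B) →
     sumℚ (λ x → sumℚ (F x) ys) xs ≡ sumℚ (λ y → sumℚ (λ x → F x y) xs) ys
sum-swap F [] ys = sym (sum-0 ys)
sum-swap F (x ∷ xs) ys = trans (cong (sumℚ (F x) ys +_) (sum-swap F xs ys))
    (sym (sum-+ (F x) (λ y → sumℚ (λ x' → F x' y) xs) ys))

sum-indicator : (p : A → Bool) (xs : List A) → sumℚ (λ x → if p x then 1ℚ else 0ℚ) xs ≡ ι (countL p xs)
sum-indicator p [] = refl
sum-indicator p (x ∷ xs) with p x
... | true = cong (1ℚ +_) (sum-indicator p xs)
... | false = trans (+-identityˡ _) (sum-indicator p xs)

ι-foldr : (F : A → ℕ) (xs : List A) → ι (foldr (λ x acc → F x ℕ.+ acc) 0 xs) ≡ sumℚ (λ x → ι (F x)) xs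
ι-foldr F [] = refl
ι-foldr F (x ∷ xs) = trans (ι-+ (F x) _) (cong (ι (F x) +_) (ι-foldr F xs))

ι-length : (xs : List A) → ι (length xs) ≡ sumℚ (λ _ → 1ℚ) xs
ι-length [] = refl
ι-length (x ∷ xs) = cong (1ℚ +_) (ι-length xs)

if-* : (b : Bool) (c F : ℚ) → (if b then c * F else 0ℚ) ≡ c * (if b then F else 0ℚ)
if-* true c F = refl
if-* false c F = sym (*-zeroʳ c)

if-0 : (b : Bool) → (if b then 0ℚ else 0ℚ) ≡ 0ℚ
if-0 true = refl
if-0 false = refl

if-sum : (c : Bool) (G : B → ℚ) (ys : List B) → (if c then sumℚ G ys else 0ℚ) ≡ sumℚ (λ y → if c then G y else 0ℚ) ys
if-sum true G ys = refl
if-sum false G ys = sym (sum-0 ys)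

if-if : (a b : Bool) (F : ℚ) → (if a then (if b then F else 0ℚ) else 0ℚ) ≡ F * (if a ∧ b then 1ℚ else 0ℚ)
if-if true true F = sym (*-identityʳ F)
if-if true false F = sym (*-zeroʳ F)
if-if false b F = sym (*-zeroʳ F)

double-count : (xs : List A) (ys : List B) (a : A → Bool) (b : A → B → Bool) (F : B → ℚ) →
  sumℚ (λ x → if a x then sumℚ (λ y → if b x y then F y else 0ℚ) ys else 0ℚ) xs
   ≡ sumℚ (λ y → F y * sumℚ (λ x → if a x ∧ b x y then 1ℚ else 0ℚ) xs) ys
double-count xs ys a b F = trans (sum-cong xs (λ x _ → if-sum (a x) (λ y → if b x y then F y else 0ℚ) ys))
  (trans (sum-swap (λ x y → if a x then (if b x y then F y else 0ℚ) else 0ℚ) xs ys)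
   (sum-cong ys (λ y _ → trans (sum-cong xs (λ x _ → if-if (a x) (b x y) (F y))) (sum-* (F y) (λ x → if a x ∧ b x y then 1ℚ else 0ℚ) xs))))

Σfin : {n : ℕ} → (Fin n → ℚ) → ℚ
Σfin {zero} F = 0ℚ
Σfin {suc n} F = F Fin.zero + Σfin (λ i → F (Fin.suc i))

sum-allFin : {n : ℕ} (F : Fin n → ℚ) → sumℚ F (allFin n) ≡ Σfin F
sum-allFin = go (λ i → i)
  where
  go : {n : ℕ} (g : Fin n → A) (F : A → ℚ) → sumℚ F (tabulate g) ≡ Σfin (λ i → F (g i))
  go {n = zero} g F = refl
  go {n = suc n} g F = cong (F (g Fin.zero) +_) (go (λ i → g (Fin.suc i)) F)

Σfin-cong : ∀ {n} {F G : Fin n → ℚ} → (∀ i → F i ≡ G i) → Σfin F ≡ Σfin G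
Σfin-cong {zero} h = refl
Σfin-cong {suc n} h = cong₂ _+_ (h Fin.zero) (Σfin-cong (λ i → h (Fin.suc i)))

Σfin-0 : ∀ {n} → Σfin {n} (λ _ → 0ℚ) ≡ 0ℚ
Σfin-0 {zero} = refl
Σfin-0 {suc n} = trans (+-identityˡ _) (Σfin-0 {n})

Σfin-+ : ∀ {n} (F G : Fin n → ℚ) → Σfin (λ i → F i + G i) ≡ Σfin F + Σfin G
Σfin-+ {zero} F G = sym (+-identityˡ 0ℚ)
Σfin-+ {suc n} F G = trans (cong (F Fin.zero + G Fin.zero +_) (Σfin-+ (λ i → F (Fin.suc i)) (λ i → G (Fin.suc i))))
    (solve 4 (λ a b c d → (a :+ b) :+ (c :+ d) := (a :+ c) :+ (b :+ d)) refl (F Fin.zero) (G Fin.zero) _ _)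

Σfin-* : ∀ {n} (c : ℚ) (F : Fin n → ℚ) → Σfin (λ i → c * F i) ≡ c * Σfin F
Σfin-* {zero} c F = sym (*-zeroʳ c)
Σfin-* {suc n} c F = trans (cong (c * F Fin.zero +_) (Σfin-* c (λ i → F (Fin.suc i)))) (sym (*-distribˡ-+ c (F Fin.zero) _))

Σfin-neg : ∀ {n} (F : Fin n → ℚ) → Σfin (λ i → - F i) ≡ - Σfin F
Σfin-neg {zero} F = refl
Σfin-neg {suc n} F = trans (cong (- F Fin.zero +_) (Σfin-neg (λ i → F (Fin.suc i)))) (sym (neg-distrib-+ (F Fin.zero) _))

Σfin-const : ∀ n (c : ℚ) → Σfin {n} (λ _ → c) ≡ ι n * c
Σfin-const zero c = sym (*-zeroˡ c)
Σfin-const (suc n) c = trans (cong (c +_) (Σfin-const n c))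
   (solve 2 (λ c x → c :+ x :* c := (con 1ℚ :+ x) :* c) refl c (ι n))

Σfin-delta : ∀ {n} (a : Fin n) (G : Fin n → ℚ) → Σfin (λ b → if does (a Fin.≟ b) then G b else 0ℚ) ≡ G a
Σfin-delta {suc n} Fin.zero G = trans (cong (G Fin.zero +_) (Σfin-0 {n})) (+-identityʳ _)
Σfin-delta {suc n} (Fin.suc a) G = trans (+-identityˡ _) (Σfin-delta a (λ b → G (Fin.suc b)))

Σfin-except : ∀ {n} (a : Fin n) (X Y : Fin n → ℚ) →
  Σfin (λ b → if does (a Fin.≟ b) then X b else Y b) ≡ (X a - Y a) + Σfin Y
Σfin-except a X Y = trans (Σfin-cong (λ b → split (does (a Fin.≟ b)) (X b) (Y b)))
  (trans (Σfin-+ _ Y) (cong (_+ Σfin Y) (Σfin-delta a (λ b → X b - Y b))))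
  where
  split : (c : Bool) (X Y : ℚ) → (if c then X else Y) ≡ (if c then X - Y else 0ℚ) + Y
  split true X Y = solve 2 (λ X Y → X := (X :- Y) :+ Y) refl X Y
  split false X Y = sym (+-identityˡ Y)

-- Relating ι to the normalised fractions a / b used in Defs, through the
-- unnormalised rationals where the arithmetic is an integer identity.

ι≃ : ∀ a → toℚᵘ (ι a) U.≃ mkℚᵘ (ℤ.+ a) 0
ι≃ zero = *≡* refl
ι≃ (suc a) = UP.≃-trans (toℚᵘ-homo-+ 1ℚ (ι a)) (UP.≃-trans (UP.+-cong (UP.≃-refl {U.1ℚᵘ}) (ι≃ a)) one+a)
  where
  one+a : (U.1ℚᵘ U.+ mkℚᵘ (ℤ.+ a) 0) U.≃ mkℚᵘ (ℤ.+ suc a) 0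
  one+a = *≡* (trans (ring (ℤ.+ a)) (cong (ℤ._* ℤ.+ 1) (sym (ℤP.pos-+ 1 a))))
    where
    ring : ∀ (x : ℤ) → (ℤ.+ 1 ℤ.* ℤ.+ 1 ℤ.+ x ℤ.* ℤ.+ 1) ℤ.* ℤ.+ 1 ≡ (ℤ.+ 1 ℤ.+ x) ℤ.* ℤ.+ 1
    ring = solve-∀

ι-/1 : ∀ k → (ℤ.+ suc k) / 1 ≡ ι (suc k)
ι-/1 k = toℚᵘ-injective (UP.≃-trans (toℚᵘ-fromℚᵘ (mkℚᵘ (ℤ.+ suc k) 0)) (UP.≃-sym (ι≃ (suc k))))

frac-* : ∀ a b → frac a (suc b) * ι (suc b) ≡ ι a
frac-* a b = toℚᵘ-injective (UP.≃-trans (toℚᵘ-homo-* (frac a (suc b)) (ι (suc b)))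
  (UP.≃-trans (UP.*-cong (toℚᵘ-fromℚᵘ (mkℚᵘ (ℤ.+ a) b)) (ι≃ (suc b)))
  (UP.≃-trans cancel (UP.≃-sym (ι≃ a)))))
  where
  ring : ∀ (x y : ℤ) → (x ℤ.* y) ℤ.* ℤ.+ 1 ≡ x ℤ.* y
  ring = solve-∀
  cancel : (mkℚᵘ (ℤ.+ a) b U.* mkℚᵘ (ℤ.+ suc b) 0) U.≃ mkℚᵘ (ℤ.+ a) 0
  cancel = *≡* (trans (ring (ℤ.+ a) (ℤ.+ suc b)) (cong (λ z → ℤ.+ a ℤ.* ℤ.+ z) (sym (ℕP.*-identityʳ (suc b)))))

frac≤lambda1 : ∀ E v k θ → ι E * ι (suc k) ≤ ι (suc v) * (ι (suc k) - θ) → frac E (suc v) ≤ lambda1 θ (suc k)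
frac≤lambda1 E v k θ h = *-cancelʳ-≤-pos (N * K) (begin
    r * (N * K)   ≡⟨ sym (*-assoc r N K) ⟩
    (r * N) * K   ≡⟨ cong (_* K) (frac-* E v) ⟩
    ι E * K       ≤⟨ h ⟩
    N * (K - θ)   ≡⟨ clear ⟩
    lambda1 θ (suc k) * (N * K) ∎)
  where
  open ≤-Reasoning
  r = frac E (suc v)
  N = ι (suc v)
  K = ι (suc k)
  w = frac 1 (suc k)
  instance
    pN : Positive N
    pN = positive (ι-pos v)
    pK : Positive K
    pK = positive (ι-pos k)
    pNK : Positive (N * K)
    pNK = pos*pos⇒pos N K
  wK : w * K ≡ 1ℚ
  wK = trans (frac-* 1 k) (+-identityʳ 1ℚ)
  clear : N * (K - θ) ≡ lambda1 θ (suc k) * (N * K)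
  clear = begin-equality
    N * (K - θ)
      ≡⟨ solve 4 (λ N K θ w → N :* (K :- θ) := ((K :- θ) :* w) :* (N :* K) :+ N :* (K :- θ) :* (con 1ℚ :- w :* K)) refl N K θ w ⟩
    ((K - θ) * w) * (N * K) + N * (K - θ) * (1ℚ - w * K)
      ≡⟨ cong (λ z → ((K - θ) * w) * (N * K) + N * (K - θ) * (1ℚ - z)) wK ⟩
    ((K - θ) * w) * (N * K) + N * (K - θ) * (1ℚ - 1ℚ)
      ≡⟨ solve 3 (λ X Y Z → X :+ Y :* (Z :- Z) := X) refl (((K - θ) * w) * (N * K)) (N * (K - θ)) 1ℚ ⟩
    ((K - θ) * w) * (N * K)
      ≡⟨ cong (λ z → ((z - θ) * w) * (N * K)) (sym (ι-/1 k)) ⟩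
    lambda1 θ (suc k) * (N * K) ∎

-- The general reduction.  Eigenvalues are studied for a 0/1 matrix `adj` on a
-- vertex list xs; for a graph G, Eigenvalue (verts G) (adj G) is exactly
-- AdjEigenvalue G.

Eigenvector : List A → (A → A → Bool) → ℚ → (A → ℚ) → Set
Eigenvector xs adj θ f = ∀ x → x ∈ xs → sumℚ (λ y → if adj x y then f y else 0ℚ) xs ≡ θ * f x

Eigenvalue : List A → (A → A → Bool) → ℚ → Set
Eigenvalue xs adj θ = Σ (_ → ℚ) λ f → (∃ λ x → x ∈ xs × f x ≢ 0ℚ) × Eigenvector xs adj θ f

SpectralGap : List A → (A → A → Bool) → ℚ → ℚ → Set
SpectralGap xs adj K gap = ∀ θ → Eigenvalue xs adj θ → θ ≡ K ⊎ θ + gap ≤ K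

-- A function on a list either vanishes on it or has a witnessed nonzero value;
-- this is the case split "is the derived vector zero?" in the gap proofs.
vanishes-or-not : (us : List A) (g : A → ℚ) → (∀ u → u ∈ us → g u ≡ 0ℚ) ⊎ (∃ λ u → u ∈ us × g u ≢ 0ℚ)
vanishes-or-not [] g = inj₁ (λ u ())
vanishes-or-not (x ∷ us) g with g x ≟ 0ℚ
... | no nz = inj₂ (x , here refl , nz)
... | yes z with vanishes-or-not us g
...   | inj₂ (u , m , nz) = inj₂ (u , there m , nz)
...   | inj₁ h = inj₁ λ { u (here refl) → z ; u (there m) → h u m }

-- A spectral gap bounds the second largest eigenvalue: θ₁ < θ₀ rules out
-- θ₁ = K, since θ₀ is then also an eigenvalue at most K.
gap-bounds-θ₁ : (G : Graph) (K gap θ₁ : ℚ) → 0ℚ ≤ gap → SpectralGap (verts G) (adj G) K gap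
  → SecondLargestEigenvalue G θ₁ → gap ≤ K - θ₁
gap-bounds-θ₁ G K gap θ₁ 0≤gap spec (θ₀ , eig₀ , eig₁ , θ₁<θ₀ , _) = bound (spec θ₁ eig₁) (spec θ₀ eig₀)
  where
  open ≤-Reasoning
  bound : θ₁ ≡ K ⊎ θ₁ + gap ≤ K → θ₀ ≡ K ⊎ θ₀ + gap ≤ K → gap ≤ K - θ₁
  bound (inj₂ le) _ = begin
    gap               ≡⟨ solve 2 (λ g t → g := (t :+ g) :- t) refl gap θ₁ ⟩
    (θ₁ + gap) - θ₁   ≤⟨ +-monoˡ-≤ (- θ₁) le ⟩
    K - θ₁ ∎
  bound (inj₁ e₁) (inj₁ e₀) = ⊥-elim (<-irrefl (trans e₁ (sym e₀)) θ₁<θ₀)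
  bound (inj₁ e₁) (inj₂ le) = ⊥-elim (<-irrefl refl (begin-strict
    θ₀        ≤⟨ ≤-+-nonneg θ₀ gap 0≤gap ⟩
    θ₀ + gap  ≤⟨ le ⟩
    K         ≡⟨ sym e₁ ⟩
    θ₁        <⟨ θ₁<θ₀ ⟩
    θ₀ ∎))

count≥1 : (p : A → Bool) {x : A} {xs : List A} → x ∈ xs → p x ≡ true → 1 ℕ.≤ countL p xs
count≥1 p {xs = y ∷ xs} (here refl) e rewrite e = ℕ.s≤s ℕ.z≤n
count≥1 p {xs = y ∷ xs} (there m) e with p y
... | true = ℕ.s≤s ℕ.z≤n
... | false = count≥1 p m e

vol-regular : (G : Graph) (k : ℕ) → Regular G k → (S : V G → Bool) → vol G S ≡ card G S ℕ.* k
vol-regular G k reg S = go (verts G) reg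
  where
  go : (xs : List (V G)) → (∀ x → x ∈ xs → deg G x ≡ k) →
       foldr (λ x acc → (if S x then deg G x else 0) ℕ.+ acc) 0 xs ≡ countL S xs ℕ.* k
  go [] _ = refl
  go (x ∷ xs) h with S x
  ... | true = cong₂ ℕ._+_ (h x (here refl)) (go xs (λ y m → h y (there m)))
  ... | false = go xs (λ y m → h y (there m))

-- If E = c·a with c ≥ 1 and a ≤ k - θ, then E/(c·k) ≤ (k - θ)/k; for k = 0
-- both sides are 0 by the conventions of frac and lambda1.
ratio-bound : ∀ E c k θ a → 1 ℕ.≤ c → ι E ≡ ι c * a → a ≤ ι k - θ → frac E (c ℕ.* k) ≤ lambda1 θ k
ratio-bound E c zero θ a _ _ _ rewrite ℕP.*-zeroʳ c = ≤-refl
ratio-bound E (suc c) (suc k) θ a _ ∂S a≤ = frac≤lambda1 E (k ℕ.+ c ℕ.* suc k) k θ (begin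
    ι E * K                ≡⟨ cong (_* K) ∂S ⟩
    (C * a) * K            ≡⟨ solve 3 (λ C a K → (C :* a) :* K := (C :* K) :* a) refl C a K ⟩
    (C * K) * a            ≤⟨ *-monoˡ-≤-nonNeg (C * K) a≤ ⟩
    (C * K) * (K - θ)      ≡⟨ cong (_* (K - θ)) (sym (ι-* (suc c) (suc k))) ⟩
    ι (suc c ℕ.* suc k) * (K - θ) ∎)
  where
  open ≤-Reasoning
  C = ι (suc c)
  K = ι (suc k)
  instance
    nnCK : NonNegative (C * K)
    nnCK = nonNegative (subst (0ℚ ≤_) (ι-* (suc c) (suc k)) (ι-nonneg (suc c ℕ.* suc k)))

cheeger-via-test-set : (G : Graph) (k : ℕ) → Regular G k → (S : V G → Bool) → Admissible G S
  → (a θ₁ : ℚ) → ι (edgeBoundary G S) ≡ ι (card G S) * a → a ≤ ι k - θ₁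
  → (h : ℚ) → IsCheegerConstant G h → h ≤ lambda1 θ₁ k
cheeger-via-test-set G k reg S adm@((x , x∈ , Sx) , _) a θ₁ ∂S a≤ h (_ , minimal) = begin
  h                                               ≤⟨ minimal S adm ⟩
  frac (edgeBoundary G S) (vol G S)               ≡⟨ cong (frac (edgeBoundary G S)) (vol-regular G k reg S) ⟩
  frac (edgeBoundary G S) (card G S ℕ.* k)        ≤⟨ ratio-bound _ _ k θ₁ a (count≥1 S x∈ Sx) ∂S a≤ ⟩
  lambda1 θ₁ k ∎
  where open ≤-Reasoning

boundary-uniform : (G : Graph) (S : V G → Bool) (a : ℚ)
  → (∀ x → x ∈ verts G → S x ≡ true → ι (countL (λ y → not (S y) ∧ adj G x y) (verts G)) ≡ a)
  → ι (edgeBoundary G S) ≡ ι (card G S) * a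
boundary-uniform G S a out = begin
  ι (edgeBoundary G S)                                  ≡⟨ ι-foldr (λ x → if S x then outside x else 0) (verts G) ⟩
  sumℚ (λ x → ι (if S x then outside x else 0)) (verts G) ≡⟨ sum-cong (verts G) each ⟩
  sumℚ (λ x → a * (if S x then 1ℚ else 0ℚ)) (verts G)   ≡⟨ sum-* a (λ x → if S x then 1ℚ else 0ℚ) (verts G) ⟩
  a * sumℚ (λ x → if S x then 1ℚ else 0ℚ) (verts G)     ≡⟨ cong (a *_) (sum-indicator S (verts G)) ⟩
  a * ι (card G S)                                      ≡⟨ *-comm a _ ⟩
  ι (card G S) * a ∎
  where
  open ≡-Reasoning
  outside : V G → ℕ
  outside x = countL (λ y → not (S y) ∧ adj G x y) (verts G)
  each : ∀ x → x ∈ verts G → ι (if S x then outside x else 0) ≡ a * (if S x then 1ℚ else 0ℚ)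
  each x x∈ with S x in Sx
  ... | true = trans (out x x∈ Sx) (sym (*-identityʳ a))
  ... | false = sym (*-zeroʳ a)

module Hamming (q' : ℕ) where

  q : ℕ
  q = suc q'

  -- q - 1, the number of neighbours of a word in one coordinate
  Q : ℚ
  Q = ι q'

  Word : ℕ → Set
  Word d = Vec (Fin q) d

  words : (d : ℕ) → List (Word d)
  words d = allVecs (allFin q) d

  ∈-words : ∀ d (u : Word d) → u ∈ words d
  ∈-words d u = allVecs-complete (allFin q) ∈-allFin d u

  adjH : ∀ {d} → Word d → Word d → Bool
  adjH u v = hammingDist u v ≡ᵇ 1

  Adj : ∀ d → (Word d → ℚ) → Word d → ℚ
  Adj d f u = sumℚ (λ v → if adjH u v then f v else 0ℚ) (words d)

  sum-words-suc : ∀ d (F : Word (suc d) → ℚ) → sumℚ F (words (suc d)) ≡ Σfin (λ a → sumℚ (λ u → F (a ∷ u)) (words d))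
  sum-words-suc d F = trans (sum-concatMap (λ a → map (a ∷_) (words d)) F (allFin q))
     (trans (sum-cong (allFin q) (λ a _ → sum-map (a ∷_) F (words d))) (sum-allFin (λ a → sumℚ (λ u → F (a ∷ u)) (words d))))

  sum-dist0 : ∀ d (u : Word d) (H : Word d → ℚ) → sumℚ (λ v → if hammingDist u v ≡ᵇ 0 then H v else 0ℚ) (words d) ≡ H u
  sum-dist0 zero [] H = +-identityʳ (H [])
  sum-dist0 (suc d) (a ∷ u) H = trans (sum-words-suc d (λ v → if hammingDist (a ∷ u) v ≡ᵇ 0 then H v else 0ℚ))
      (trans (Σfin-cong first-letter) (Σfin-delta a (λ b → H (b ∷ u))))
    where
    first-letter : ∀ b → sumℚ (λ v → if hammingDist (a ∷ u) (b ∷ v) ≡ᵇ 0 then H (b ∷ v) else 0ℚ) (words d)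
                 ≡ (if does (a Fin.≟ b) then H (b ∷ u) else 0ℚ)
    first-letter b with does (a Fin.≟ b)
    ... | true = sum-dist0 d u (λ v → H (b ∷ v))
    ... | false = sum-0 (words d)

  -- A neighbour of a ∷ u either keeps the letter a (and is a neighbour of u in
  -- the tail) or changes it to some b ≠ a (and keeps the tail u).
  Adj-cons : ∀ d (a : Fin q) (u : Word d) (F : Word (suc d) → ℚ) →
    Adj (suc d) F (a ∷ u) ≡ (Adj d (λ v → F (a ∷ v)) u - F (a ∷ u)) + Σfin (λ b → F (b ∷ u))
  Adj-cons d a u F = trans (sum-words-suc d (λ y → if adjH (a ∷ u) y then F y else 0ℚ))
      (trans (Σfin-cong first-letter) (Σfin-except a (λ b → Adj d (λ v → F (b ∷ v)) u) (λ b → F (b ∷ u))))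
    where
    first-letter : ∀ b → sumℚ (λ v → if adjH (a ∷ u) (b ∷ v) then F (b ∷ v) else 0ℚ) (words d)
                 ≡ (if does (a Fin.≟ b) then Adj d (λ v → F (b ∷ v)) u else F (b ∷ u))
    first-letter b with does (a Fin.≟ b)
    ... | true = refl
    ... | false = sum-dist0 d u (λ v → F (b ∷ v))

  Adj-Σfin : ∀ d (f : Word (suc d) → ℚ) (u : Word d) →
     Σfin (λ a → Adj d (λ v → f (a ∷ v)) u) ≡ Adj d (λ v → Σfin (λ a → f (a ∷ v))) u
  Adj-Σfin d f u = trans (sym (sum-allFin (λ a → Adj d (λ v → f (a ∷ v)) u)))
      (trans (sum-swap (λ a v → if adjH u v then f (a ∷ v) else 0ℚ) (allFin q) (words d))
      (sum-cong (words d) (λ v _ → pull (adjH u v) v)))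
    where
    pull : ∀ c v → sumℚ (λ a → if c then f (a ∷ v) else 0ℚ) (allFin q) ≡ (if c then Σfin (λ a → f (a ∷ v)) else 0ℚ)
    pull true v = sum-allFin (λ a → f (a ∷ v))
    pull false v = sum-0 (allFin q)

  K : ℕ → ℚ
  K d = ι d * Q

  degree : ∀ d (u : Word d) → Adj d (λ _ → 1ℚ) u ≡ K d
  degree zero [] = trans (+-identityˡ 0ℚ) (sym (*-zeroˡ Q))
  degree (suc d) (a ∷ u) = begin
     Adj (suc d) (λ _ → 1ℚ) (a ∷ u)            ≡⟨ Adj-cons d a u (λ _ → 1ℚ) ⟩
     (Adj d (λ _ → 1ℚ) u - 1ℚ) + Σfin {q} (λ _ → 1ℚ)
       ≡⟨ cong₂ (λ x y → (x - 1ℚ) + y) (degree d u) (Σfin-const q 1ℚ) ⟩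
     (ι d * Q - 1ℚ) + (1ℚ + Q) * 1ℚ
       ≡⟨ solve 2 (λ D Q → (D :* Q :- con 1ℚ) :+ (con 1ℚ :+ Q) :* con 1ℚ := (con 1ℚ :+ D) :* Q) refl (ι d) Q ⟩
     K (suc d) ∎
    where open ≡-Reasoning

  Σfirst : ∀ {d} → (Word (suc d) → ℚ) → Word d → ℚ
  Σfirst f v = Σfin (λ b → f (b ∷ v))

  summed-eigenvector : ∀ d θ f → Eigenvector (words (suc d)) adjH θ f
    → Eigenvector (words d) adjH (θ - Q) (Σfirst f)
  summed-eigenvector d θ f eig v _ = begin
     Adj d g v
       ≡⟨ solve 3 (λ X G Q → X := ((X :- G) :+ (con 1ℚ :+ Q) :* G) :- Q :* G) refl (Adj d g v) (g v) Q ⟩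
     ((Adj d g v - g v) + (1ℚ + Q) * g v) - Q * g v
       ≡⟨ cong₂ (λ x y → ((x - g v) + y) - Q * g v) (sym (Adj-Σfin d f v)) (sym (Σfin-const q (g v))) ⟩
     ((Σfin (λ b → Adj d (λ w → f (b ∷ w)) v) + - Σfin (λ b → f (b ∷ v))) + Σfin {q} (λ _ → g v)) - Q * g v
       ≡⟨ cong (λ z → (z + Σfin {q} (λ _ → g v)) - Q * g v) (sym (trans (Σfin-+ {q} (λ b → Adj d (λ w → f (b ∷ w)) v) (λ b → - f (b ∷ v)))
            (cong (Σfin (λ b → Adj d (λ w → f (b ∷ w)) v) +_) (Σfin-neg (λ b → f (b ∷ v)))))) ⟩
     (Σfin (λ b → Adj d (λ w → f (b ∷ w)) v - f (b ∷ v)) + Σfin {q} (λ _ → g v)) - Q * g v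
       ≡⟨ cong (_- Q * g v) (sym (Σfin-+ (λ b → Adj d (λ w → f (b ∷ w)) v - f (b ∷ v)) (λ _ → g v))) ⟩
     Σfin (λ b → (Adj d (λ w → f (b ∷ w)) v - f (b ∷ v)) + g v) - Q * g v
       ≡⟨ cong (_- Q * g v) (Σfin-cong (λ b → trans (sym (Adj-cons d b v f)) (eig (b ∷ v) (∈-words _ _)))) ⟩
     Σfin (λ b → θ * f (b ∷ v)) - Q * g v
       ≡⟨ cong (_- Q * g v) (Σfin-* θ (λ b → f (b ∷ v))) ⟩
     θ * g v - Q * g v
       ≡⟨ solve 3 (λ T G Q → T :* G :- Q :* G := (T :- Q) :* G) refl θ (g v) Q ⟩
     (θ - Q) * g v ∎
    where
    open ≡-Reasoning
    g = Σfirst f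

  slice-eigenvector : ∀ d θ f (a : Fin q) → Eigenvector (words (suc d)) adjH θ f
    → (∀ v → v ∈ words d → Σfirst f v ≡ 0ℚ)
    → Eigenvector (words d) adjH (θ + 1ℚ) (λ w → f (a ∷ w))
  slice-eigenvector d θ f a eig g≡0 v v∈ = begin
     Adj d fa v
       ≡⟨ solve 3 (λ X F G → X := ((X :- F) :+ G) :+ F :- G) refl (Adj d fa v) (fa v) (Σfirst f v) ⟩
     ((Adj d fa v - fa v) + Σfirst f v) + fa v - Σfirst f v
       ≡⟨ cong₂ (λ x y → x + fa v - y) (trans (sym (Adj-cons d a v f)) (eig (a ∷ v) (∈-words _ _))) (g≡0 v v∈) ⟩
     θ * fa v + fa v - 0ℚ
       ≡⟨ solve 2 (λ T F → T :* F :+ F :- con 0ℚ := (T :+ con 1ℚ) :* F) refl θ (fa v) ⟩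
     (θ + 1ℚ) * fa v ∎
    where
    open ≡-Reasoning
    fa = λ w → f (a ∷ w)

  -- Passing from d to d+1 raises the valency by q-1; both shifts of the
  -- eigenvalue (by q-1 resp. by -1) preserve the dichotomy.
  gap-after-sum : ∀ d θ → (θ - Q ≡ K d) ⊎ (θ - Q + ι q ≤ K d) → θ ≡ K (suc d) ⊎ θ + ι q ≤ K (suc d)
  gap-after-sum d θ (inj₁ e) = inj₁ (begin
     θ                ≡⟨ solve 2 (λ θ Q → θ := (θ :- Q) :+ Q) refl θ Q ⟩
     (θ - Q) + Q      ≡⟨ cong (_+ Q) e ⟩
     ι d * Q + Q      ≡⟨ solve 2 (λ D Q → D :* Q :+ Q := (con 1ℚ :+ D) :* Q) refl (ι d) Q ⟩
     K (suc d) ∎)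
    where open ≡-Reasoning
  gap-after-sum d θ (inj₂ le) = inj₂ (begin
     θ + ι q                  ≡⟨ solve 2 (λ θ Q → θ :+ (con 1ℚ :+ Q) := (θ :- Q :+ (con 1ℚ :+ Q)) :+ Q) refl θ Q ⟩
     (θ - Q + ι q) + Q        ≤⟨ +-monoˡ-≤ Q le ⟩
     ι d * Q + Q              ≡⟨ solve 2 (λ D Q → D :* Q :+ Q := (con 1ℚ :+ D) :* Q) refl (ι d) Q ⟩
     K (suc d) ∎)
    where open ≤-Reasoning

  gap-after-slice : ∀ d θ → (θ + 1ℚ ≡ K d) ⊎ (θ + 1ℚ + ι q ≤ K d) → θ + ι q ≤ K (suc d)
  gap-after-slice d θ (inj₁ e) = ≤-reflexive (begin
     θ + ι q           ≡⟨ solve 2 (λ θ Q → θ :+ (con 1ℚ :+ Q) := (θ :+ con 1ℚ) :+ Q) refl θ Q ⟩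
     (θ + 1ℚ) + Q      ≡⟨ cong (_+ Q) e ⟩
     ι d * Q + Q       ≡⟨ solve 2 (λ D Q → D :* Q :+ Q := (con 1ℚ :+ D) :* Q) refl (ι d) Q ⟩
     K (suc d) ∎)
    where open ≡-Reasoning
  gap-after-slice d θ (inj₂ le) = begin
     θ + ι q                 ≤⟨ ≤-+-nonneg (θ + ι q) 1ℚ (ι-nonneg 1) ⟩
     θ + ι q + 1ℚ            ≡⟨ solve 2 (λ θ Q → θ :+ (con 1ℚ :+ Q) :+ con 1ℚ := θ :+ con 1ℚ :+ (con 1ℚ :+ Q)) refl θ Q ⟩
     θ + 1ℚ + ι q            ≤⟨ le ⟩
     ι d * Q                 ≤⟨ ≤-+-nonneg (ι d * Q) Q (ι-nonneg q') ⟩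
     ι d * Q + Q             ≡⟨ solve 2 (λ D Q → D :* Q :+ Q := (con 1ℚ :+ D) :* Q) refl (ι d) Q ⟩
     K (suc d) ∎
    where open ≤-Reasoning

  hamming-gap : ∀ d → SpectralGap (words d) adjH (K d) (ι q)
  hamming-gap zero θ (f , ([] , _ , nz) , eig) =
    inj₁ (trans (cancel-≢0 θ (f []) (sym (trans (+-identityˡ 0ℚ) (eig [] (here refl)))) nz) (sym (*-zeroˡ Q)))
  hamming-gap (suc d) θ (f , ((a ∷ u) , _ , nz) , eig) with vanishes-or-not (words d) (Σfirst f)
  ... | inj₂ (u₀ , u₀∈ , g≢0) =
        gap-after-sum d θ (hamming-gap d (θ - Q) (Σfirst f , (u₀ , u₀∈ , g≢0) , summed-eigenvector d θ f eig))
  ... | inj₁ g≡0 =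
        inj₂ (gap-after-slice d θ (hamming-gap d (θ + 1ℚ) (_ , (u , ∈-words d u , nz) , slice-eigenvector d θ f a eig g≡0)))

  isZero : Fin q → Bool
  isZero Fin.zero = true
  isZero (Fin.suc _) = false

  firstIsZero : ∀ {d} → Word (suc d) → Bool
  firstIsZero (a ∷ _) = isZero a

  sum-firstIsZero : ∀ d (F : Word (suc d) → ℚ) →
    sumℚ (λ x → if firstIsZero x then F x else 0ℚ) (words (suc d)) ≡ sumℚ (λ u → F (Fin.zero ∷ u)) (words d)
  sum-firstIsZero d F = trans (sum-words-suc d (λ x → if firstIsZero x then F x else 0ℚ))
     (trans (cong (sumℚ (λ u → F (Fin.zero ∷ u)) (words d) +_) (trans (Σfin-cong {q'} (λ _ → sum-0 (words d))) (Σfin-0 {q'})))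
            (+-identityʳ _))

  -- a word 0 ∷ u has exactly q - 1 neighbours outside the test set: b ∷ u, b ≠ 0
  outside-firstIsZero : ∀ d (u : Word d) →
    ι (countL (λ y → not (firstIsZero y) ∧ adjH (Fin.zero ∷ u) y) (words (suc d))) ≡ Q
  outside-firstIsZero d u = begin
     ι (countL (λ y → not (firstIsZero y) ∧ adjH (Fin.zero ∷ u) y) (words (suc d)))
        ≡⟨ sym (sum-indicator _ (words (suc d))) ⟩
     sumℚ (λ y → if not (firstIsZero y) ∧ adjH (Fin.zero ∷ u) y then 1ℚ else 0ℚ) (words (suc d))
        ≡⟨ sum-words-suc d (λ y → if not (firstIsZero y) ∧ adjH (Fin.zero ∷ u) y then 1ℚ else 0ℚ) ⟩
     sumℚ (λ _ → 0ℚ) (words d) + Σfin {q'} (λ _ → sumℚ (λ v → if hammingDist u v ≡ᵇ 0 then 1ℚ else 0ℚ) (words d))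
        ≡⟨ cong₂ _+_ (sum-0 (words d)) (Σfin-cong {q'} (λ _ → sum-dist0 d u (λ _ → 1ℚ))) ⟩
     0ℚ + Σfin {q'} (λ _ → 1ℚ)   ≡⟨ +-identityˡ _ ⟩
     Σfin {q'} (λ _ → 1ℚ)        ≡⟨ Σfin-const q' 1ℚ ⟩
     Q * 1ℚ                      ≡⟨ *-identityʳ Q ⟩
     Q ∎
    where open ≡-Reasoning

  module TestSet (d : ℕ) where

    G : Graph
    G = hamming (suc d) q

    M : ℚ
    M = sumℚ (λ _ → 1ℚ) (words d)

    x₀ : Word (suc d)
    x₀ = Fin.zero ∷ replicate d Fin.zero

    valency : ∀ x → ι (deg G x) ≡ K (suc d)
    valency x = trans (sym (sum-indicator (adjH x) (words (suc d)))) (degree (suc d) x)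

    ∂S : ι (edgeBoundary G firstIsZero) ≡ ι (card G firstIsZero) * Q
    ∂S = boundary-uniform G firstIsZero Q out
      where
      out : ∀ x → x ∈ verts G → firstIsZero x ≡ true →
            ι (countL (λ y → not (firstIsZero y) ∧ adj G x y) (verts G)) ≡ Q
      out (Fin.zero ∷ u) _ _ = outside-firstIsZero d u

    |S| : ι (card G firstIsZero) ≡ M
    |S| = trans (sym (sum-indicator firstIsZero (words (suc d)))) (sum-firstIsZero d (λ _ → 1ℚ))

    |V| : ι (length (verts G)) ≡ ι q * M
    |V| = trans (ι-length (words (suc d))) (trans (sum-words-suc d (λ _ → 1ℚ)) (Σfin-const q M))

    admissible : 1 ℕ.≤ q' → Admissible G firstIsZero
    admissible 1≤q' = (x₀ , ∈-words (suc d) x₀ , refl) , ι-reflect (begin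
        ι (2 ℕ.* card G firstIsZero)   ≡⟨ ι-* 2 (card G firstIsZero) ⟩
        ι 2 * ι (card G firstIsZero)   ≡⟨ cong (ι 2 *_) |S| ⟩
        ι 2 * M                        ≤⟨ *-monoʳ-≤-nonNeg M (ι-mono (ℕ.s≤s 1≤q')) ⟩
        ι q * M                        ≡⟨ sym |V| ⟩
        ι (length (verts G)) ∎)
      where
      open ≤-Reasoning
      instance
        nnM : NonNegative M
        nnM = nonNegative (subst (0ℚ ≤_) |S| (ι-nonneg (card G firstIsZero)))

  hamming-cheeger : ∀ d → 1 ℕ.≤ q' → (k : ℕ) → Regular (hamming (suc d) q) k
    → (θ₁ : ℚ) → SecondLargestEigenvalue (hamming (suc d) q) θ₁
    → (h : ℚ) → IsCheegerConstant (hamming (suc d) q) h → h ≤ lambda1 θ₁ k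
  hamming-cheeger d 1≤q' k reg θ₁ second h cheeger =
    cheeger-via-test-set G k reg firstIsZero (admissible 1≤q') Q θ₁ ∂S (≤-trans Q≤q gap) h cheeger
    where
    open TestSet d
    k≡K : ι k ≡ K (suc d)
    k≡K = trans (cong ι (sym (reg x₀ (∈-words (suc d) x₀)))) (valency x₀)
    gap : ι q ≤ ι k - θ₁
    gap = subst (λ K → ι q ≤ K - θ₁) (sym k≡K)
            (gap-bounds-θ₁ G (K (suc d)) (ι q) θ₁ (ι-nonneg q) (hamming-gap (suc d)) second)
    Q≤q : Q ≤ ι q
    Q≤q = ι-mono (ℕP.n≤1+n q')

≡ᵇ-refl : ∀ m → (m ≡ᵇ m) ≡ true
≡ᵇ-refl zero = refl
≡ᵇ-refl (suc m) = ≡ᵇ-refl m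

≡ᵇ-false : ∀ {a b} → a ≢ b → (a ≡ᵇ b) ≡ false
≡ᵇ-false {a} {b} ne with a ≡ᵇ b in eq
... | false = refl
... | true = ⊥-elim (ne (ℕP.≡ᵇ⇒≡ a b (subst T (sym eq) tt)))

-- Inclusion and equality are also
-- needed as Boolean tests, to appear in indicator sums.

infix 4 _⊆ᵇ_ _≡ˢ_

_⊆ᵇ_ : ∀ {k} → Subset k → Subset k → Bool
[] ⊆ᵇ [] = true
(a ∷ s) ⊆ᵇ (b ∷ u) = (not a ∨ b) ∧ (s ⊆ᵇ u)

_≡ˢ_ : ∀ {k} → Subset k → Subset k → Bool
[] ≡ˢ [] = true
(true ∷ u) ≡ˢ (true ∷ v) = u ≡ˢ v
(false ∷ u) ≡ˢ (false ∷ v) = u ≡ˢ v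
(true ∷ u) ≡ˢ (false ∷ v) = false
(false ∷ u) ≡ˢ (true ∷ v) = false

≡ˢ-refl : ∀ {k} (u : Subset k) → (u ≡ˢ u) ≡ true
≡ˢ-refl [] = refl
≡ˢ-refl (true ∷ u) = ≡ˢ-refl u
≡ˢ-refl (false ∷ u) = ≡ˢ-refl u

≡ˢ-sound : ∀ {k} (u v : Subset k) → (u ≡ˢ v) ≡ true → u ≡ v
≡ˢ-sound [] [] e = refl
≡ˢ-sound (true ∷ u) (true ∷ v) e = cong (true ∷_) (≡ˢ-sound u v e)
≡ˢ-sound (false ∷ u) (false ∷ v) e = cong (false ∷_) (≡ˢ-sound u v e)

⊆ᵇ-∩ : ∀ {k} (s u v : Subset k) → ((s ⊆ᵇ u) ∧ (s ⊆ᵇ v)) ≡ (s ⊆ᵇ u ∩ v)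
⊆ᵇ-∩ [] [] [] = refl
⊆ᵇ-∩ (false ∷ s) (b ∷ u) (c ∷ v) = ⊆ᵇ-∩ s u v
⊆ᵇ-∩ (true ∷ s) (true ∷ u) (true ∷ v) = ⊆ᵇ-∩ s u v
⊆ᵇ-∩ (true ∷ s) (true ∷ u) (false ∷ v) = ∧-zeroʳ (s ⊆ᵇ u)
⊆ᵇ-∩ (true ∷ s) (false ∷ u) (c ∷ v) = refl

∪-⊆ᵇ : ∀ {k} (s t u : Subset k) → ((s ⊆ᵇ u) ∧ (t ⊆ᵇ u)) ≡ (s ∪ t ⊆ᵇ u)
∪-⊆ᵇ [] [] [] = refl
∪-⊆ᵇ (true ∷ s) (true ∷ t) (true ∷ u) = ∪-⊆ᵇ s t u
∪-⊆ᵇ (true ∷ s) (false ∷ t) (true ∷ u) = ∪-⊆ᵇ s t u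
∪-⊆ᵇ (false ∷ s) (true ∷ t) (true ∷ u) = ∪-⊆ᵇ s t u
∪-⊆ᵇ (false ∷ s) (false ∷ t) (true ∷ u) = ∪-⊆ᵇ s t u
∪-⊆ᵇ (true ∷ s) (c ∷ t) (false ∷ u) = refl
∪-⊆ᵇ (false ∷ s) (true ∷ t) (false ∷ u) = ∧-zeroʳ (s ⊆ᵇ u)
∪-⊆ᵇ (false ∷ s) (false ∷ t) (false ∷ u) = ∪-⊆ᵇ s t u

∩-size-⊆ᵇ : ∀ {k} (p q : Subset k) → (∣ p ∩ q ∣ ≡ᵇ ∣ p ∣) ≡ (p ⊆ᵇ q)
∩-size-⊆ᵇ [] [] = refl
∩-size-⊆ᵇ (true ∷ p) (true ∷ q) = ∩-size-⊆ᵇ p q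
∩-size-⊆ᵇ (true ∷ p) (false ∷ q) = ≡ᵇ-false (ℕP.<⇒≢ (ℕ.s≤s (∣p∩q∣≤∣p∣ p q)))
∩-size-⊆ᵇ (false ∷ p) (b ∷ q) = ∩-size-⊆ᵇ p q

⊆ᵇ-⊤ : ∀ {k} (s : Subset k) → (s ⊆ᵇ ⊤) ≡ true
⊆ᵇ-⊤ [] = refl
⊆ᵇ-⊤ (true ∷ s) = ⊆ᵇ-⊤ s
⊆ᵇ-⊤ (false ∷ s) = ⊆ᵇ-⊤ s

∣∪∣+∣∩∣ : ∀ {k} (s t : Subset k) → ∣ s ∪ t ∣ ℕ.+ ∣ s ∩ t ∣ ≡ ∣ s ∣ ℕ.+ ∣ t ∣
∣∪∣+∣∩∣ [] [] = refl
∣∪∣+∣∩∣ (true ∷ s) (true ∷ t) = cong suc (trans (ℕP.+-suc ∣ s ∪ t ∣ ∣ s ∩ t ∣) (trans (cong suc (∣∪∣+∣∩∣ s t)) (sym (ℕP.+-suc ∣ s ∣ ∣ t ∣))))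
∣∪∣+∣∩∣ (true ∷ s) (false ∷ t) = cong suc (∣∪∣+∣∩∣ s t)
∣∪∣+∣∩∣ (false ∷ s) (true ∷ t) = trans (cong suc (∣∪∣+∣∩∣ s t)) (sym (ℕP.+-suc ∣ s ∣ ∣ t ∣))
∣∪∣+∣∩∣ (false ∷ s) (false ∷ t) = ∣∪∣+∣∩∣ s t

∣p∣+∣∁p∣ : ∀ {k} (p : Subset k) → ∣ p ∣ ℕ.+ ∣ ∁ p ∣ ≡ k
∣p∣+∣∁p∣ p = trans (cong (∣ p ∣ ℕ.+_) (∣∁p∣≡n∸∣p∣ p)) (ℕP.m+[n∸m]≡n (∣p∣≤n p))

≡-from-∩ : ∀ {k} (u v : Subset k) → ∣ u ∣ ≡ ∣ u ∩ v ∣ → ∣ v ∣ ≡ ∣ u ∩ v ∣ → u ≡ v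
≡-from-∩ [] [] _ _ = refl
≡-from-∩ (true ∷ u) (true ∷ v) e1 e2 = cong (true ∷_) (≡-from-∩ u v (ℕP.suc-injective e1) (ℕP.suc-injective e2))
≡-from-∩ (false ∷ u) (false ∷ v) e1 e2 = cong (false ∷_) (≡-from-∩ u v e1 e2)
≡-from-∩ (true ∷ u) (false ∷ v) e1 e2 = ⊥-elim (ℕP.<-irrefl refl (subst (ℕ._≤ ∣ u ∣) (sym e1) (∣p∩q∣≤∣p∣ u v)))
≡-from-∩ (false ∷ u) (true ∷ v) e1 e2 = ⊥-elim (ℕP.<-irrefl refl (subst (ℕ._≤ ∣ v ∣) (sym e2) (∣p∩q∣≤∣q∣ u v)))

∩-size≡-iff-≡ˢ : ∀ {k} m (u v : Subset k) → ∣ u ∣ ≡ m → ∣ v ∣ ≡ m →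
  ((u ≡ˢ v) ≡ true → ∣ u ∩ v ∣ ≡ m) × ((u ≡ˢ v) ≡ false → ∣ u ∩ v ∣ ≢ m)
∩-size≡-iff-≡ˢ m u v eu ev = equal , distinct
  where
  equal : (u ≡ˢ v) ≡ true → ∣ u ∩ v ∣ ≡ m
  equal e with ≡ˢ-sound u v e
  ... | refl = trans (cong ∣_∣ (∩-idem u)) eu
  distinct : (u ≡ˢ v) ≡ false → ∣ u ∩ v ∣ ≢ m
  distinct e j with ≡-from-∩ u v (trans eu (sym j)) (trans ev (sym j))
  ... | refl with trans (sym e) (≡ˢ-refl u)
  ...   | ()

subset-of-size : ∀ k E → E ℕ.≤ k → Σ (Subset k) (λ p → ∣ p ∣ ≡ E)
subset-of-size zero zero _ = [] , refl
subset-of-size (suc k) zero _ = false ∷ proj₁ (subset-of-size k zero ℕ.z≤n) , proj₂ (subset-of-size k zero ℕ.z≤n)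
subset-of-size (suc k) (suc E) (ℕ.s≤s h) = true ∷ proj₁ (subset-of-size k E h) , cong suc (proj₂ (subset-of-size k E h))

-- Counting subsets.  choose r m is the binomial coefficient by Pascal's rule;
-- chooseAbove r a m = choose r (m - a) (0 if m < a) counts the m-sets that
-- contain a fixed a-set inside a universe with r further points.

choose : ℕ → ℕ → ℕ
choose _ zero = 1
choose zero (suc k) = 0
choose (suc n) (suc k) = choose n k ℕ.+ choose n (suc k)

chooseAbove : ℕ → ℕ → ℕ → ℕ
chooseAbove r zero m = choose r m
chooseAbove r (suc a) zero = 0
chooseAbove r (suc a) (suc m) = chooseAbove r a m

choose-> : ∀ j k → j ℕ.< k → choose j k ≡ 0
choose-> zero (suc k) _ = refl
choose-> (suc j) (suc k) (ℕ.s≤s h) = cong₂ ℕ._+_ (choose-> j k h) (choose-> j (suc k) (ℕP.m≤n⇒m≤1+n h))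

choose-diag : ∀ j → choose j j ≡ 1
choose-diag zero = refl
choose-diag (suc j) = cong₂ ℕ._+_ (choose-diag j) (choose-> j (suc j) ℕP.≤-refl)

choose-1+ : ∀ j → choose (suc j) j ≡ suc j
choose-1+ zero = refl
choose-1+ (suc j) = trans (cong₂ ℕ._+_ (choose-1+ j) (choose-diag (suc j))) (ℕP.+-comm (suc j) 1)

choose-1 : ∀ r → choose r 1 ≡ r
choose-1 zero = refl
choose-1 (suc r) = cong suc (choose-1 r)

choose-absorb : ∀ N k → ι (choose N (suc k)) * ι (suc k) + ι (choose N k) * ι k ≡ ι (choose N k) * ι N
choose-absorb zero zero = refl
choose-absorb zero (suc k) = trans (cong₂ _+_ (*-zeroˡ (ι (suc (suc k)))) (*-zeroˡ (ι (suc k)))) (trans (+-identityˡ 0ℚ) (sym (*-zeroˡ 0ℚ)))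
choose-absorb (suc N) zero = begin
    ι (choose N 0 ℕ.+ choose N 1) * ι 1 + ι 1 * ι 0  ≡⟨ cong (λ z → ι (1 ℕ.+ z) * ι 1 + ι 1 * ι 0) (choose-1 N) ⟩
    ι (suc N) * ι 1 + ι 1 * ι 0
      ≡⟨ solve 1 (λ x → (con 1ℚ :+ x) :* (con 1ℚ :+ con 0ℚ) :+ (con 1ℚ :+ con 0ℚ) :* con 0ℚ := (con 1ℚ :+ con 0ℚ) :* (con 1ℚ :+ x)) refl (ι N) ⟩
    ι 1 * ι (suc N) ∎
  where open ≡-Reasoning
choose-absorb (suc N) (suc k) = begin
    ι (choose N (suc k) ℕ.+ choose N (suc (suc k))) * ι (suc (suc k)) + ι (choose N k ℕ.+ choose N (suc k)) * ι (suc k)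
      ≡⟨ cong₂ (λ x y → x * ι (suc (suc k)) + y * ι (suc k)) (ι-+ (choose N (suc k)) _) (ι-+ (choose N k) _) ⟩
    (a + b) * (1ℚ + (1ℚ + kq)) + (a' + a) * (1ℚ + kq)
      ≡⟨ solve 6 (λ a b a' k N x → (a :+ b) :* (con 1ℚ :+ (con 1ℚ :+ k)) :+ (a' :+ a) :* (con 1ℚ :+ k)
           := (a' :+ a) :* (con 1ℚ :+ N) :+ ((b :* (con 1ℚ :+ (con 1ℚ :+ k)) :+ a :* (con 1ℚ :+ k)) :- a :* N)
              :+ ((a :* (con 1ℚ :+ k) :+ a' :* k) :- a' :* N)) refl a b a' kq Nq kq ⟩
    (a' + a) * (1ℚ + Nq) + ((b * (1ℚ + (1ℚ + kq)) + a * (1ℚ + kq)) - a * Nq) + ((a * (1ℚ + kq) + a' * kq) - a' * Nq)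
      ≡⟨ cong₂ (λ x y → (a' + a) * (1ℚ + Nq) + (x - a * Nq) + (y - a' * Nq)) (choose-absorb N (suc k)) (choose-absorb N k) ⟩
    (a' + a) * (1ℚ + Nq) + (a * Nq - a * Nq) + (a' * Nq - a' * Nq)
      ≡⟨ solve 3 (λ a a' N → (a' :+ a) :* (con 1ℚ :+ N) :+ (a :* N :- a :* N) :+ (a' :* N :- a' :* N) := (a' :+ a) :* (con 1ℚ :+ N)) refl a a' Nq ⟩
    (a' + a) * (1ℚ + Nq)
      ≡⟨ cong (_* ι (suc N)) (sym (ι-+ (choose N k) _)) ⟩
    ι (choose N k ℕ.+ choose N (suc k)) * ι (suc N) ∎
  where
  open ≡-Reasoning
  a = ι (choose N (suc k))
  b = ι (choose N (suc (suc k)))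
  a' = ι (choose N k)
  kq = ι k
  Nq = ι N

chooseAbove-< : ∀ r a m → m ℕ.< a → chooseAbove r a m ≡ 0
chooseAbove-< r (suc a) zero _ = refl
chooseAbove-< r (suc a) (suc m) (ℕ.s≤s h) = chooseAbove-< r a m h

chooseAbove-+ : ∀ r a i → chooseAbove r a (a ℕ.+ i) ≡ choose r i
chooseAbove-+ r zero i = refl
chooseAbove-+ r (suc a) i = chooseAbove-+ r a i

chooseAbove-1+ : ∀ r a → chooseAbove r a (suc a) ≡ r
chooseAbove-1+ r a = trans (cong (chooseAbove r a) (ℕP.+-comm 1 a)) (trans (chooseAbove-+ r a 1) (choose-1 r))

chooseAbove-pascal-0 : ∀ r a → chooseAbove (suc r) a 0 ≡ chooseAbove r a 0
chooseAbove-pascal-0 r zero = refl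
chooseAbove-pascal-0 r (suc a) = refl

chooseAbove-pascal : ∀ r a m → chooseAbove (suc r) a (suc m) ≡ chooseAbove r a m ℕ.+ chooseAbove r a (suc m)
chooseAbove-pascal r zero m = refl
chooseAbove-pascal r (suc a) zero = chooseAbove-pascal-0 r a
chooseAbove-pascal r (suc a) (suc m) = chooseAbove-pascal r a m

subsets : (k : ℕ) → List (Subset k)
subsets k = allVecs (true ∷ false ∷ []) k

∈-subsets : ∀ k (p : Subset k) → p ∈ subsets k
∈-subsets k p = allVecs-complete (true ∷ false ∷ []) (λ { true → here refl ; false → there (here refl) }) k p

sum-subsets-suc : ∀ k (F : Subset (suc k) → ℚ) →
  sumℚ F (subsets (suc k)) ≡ sumℚ (λ u → F (true ∷ u)) (subsets k) + sumℚ (λ u → F (false ∷ u)) (subsets k)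
sum-subsets-suc k F = trans (sum-concatMap (λ a → map (a ∷_) (subsets k)) F (true ∷ false ∷ []))
  (cong₂ _+_ (sum-map (true ∷_) F (subsets k)) (trans (+-identityʳ _) (sum-map (false ∷_) F (subsets k))))

IsSubOfSize : ∀ {k} → Subset k → ℕ → Subset k → ℚ
IsSubOfSize z m s = if ∣ s ∣ ≡ᵇ m then (if s ⊆ᵇ z then 1ℚ else 0ℚ) else 0ℚ

IsSuperOfSize : ∀ {k} → Subset k → ℕ → Subset k → ℚ
IsSuperOfSize w m u = if ∣ u ∣ ≡ᵇ m then (if w ⊆ᵇ u then 1ℚ else 0ℚ) else 0ℚ

count-subsets : ∀ k (z : Subset k) m → sumℚ (IsSubOfSize z m) (subsets k) ≡ ι (choose ∣ z ∣ m)
count-subsets zero [] zero = refl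
count-subsets zero [] (suc m) = +-identityˡ 0ℚ
count-subsets (suc k) (true ∷ z) zero = trans (sum-subsets-suc k (IsSubOfSize (true ∷ z) 0))
  (trans (cong (_+ sumℚ (IsSubOfSize z 0) (subsets k)) (sum-0 (subsets k))) (trans (+-identityˡ _) (count-subsets k z 0)))
count-subsets (suc k) (true ∷ z) (suc m) = trans (sum-subsets-suc k (IsSubOfSize (true ∷ z) (suc m)))
  (trans (cong₂ _+_ (count-subsets k z m) (count-subsets k z (suc m))) (sym (ι-+ (choose ∣ z ∣ m) _)))
count-subsets (suc k) (false ∷ z) m = trans (sum-subsets-suc k (IsSubOfSize (false ∷ z) m))
  (trans (cong (_+ sumℚ (IsSubOfSize z m) (subsets k)) (sum-zero (subsets k) _ (λ s → if-0 (suc ∣ s ∣ ≡ᵇ m))))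
         (trans (+-identityˡ _) (count-subsets k z m)))

count-supersets : ∀ k (w : Subset k) m → sumℚ (IsSuperOfSize w m) (subsets k) ≡ ι (chooseAbove (∣ ∁ w ∣) (∣ w ∣) m)
count-supersets zero [] zero = refl
count-supersets zero [] (suc m) = +-identityˡ 0ℚ
count-supersets (suc k) (true ∷ w) zero = trans (sum-subsets-suc k (IsSuperOfSize (true ∷ w) 0))
  (trans (cong₂ _+_ (sum-0 (subsets k)) (sum-zero (subsets k) _ (λ u → if-0 (∣ u ∣ ≡ᵇ 0)))) (+-identityˡ 0ℚ))
count-supersets (suc k) (true ∷ w) (suc m) = trans (sum-subsets-suc k (IsSuperOfSize (true ∷ w) (suc m)))
  (trans (cong₂ _+_ (count-supersets k w m) (sum-zero (subsets k) _ (λ u → if-0 (∣ u ∣ ≡ᵇ suc m)))) (+-identityʳ _))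
count-supersets (suc k) (false ∷ w) zero = trans (sum-subsets-suc k (IsSuperOfSize (false ∷ w) 0))
  (trans (cong₂ _+_ (sum-0 (subsets k)) (count-supersets k w 0))
         (trans (+-identityˡ _) (cong ι (sym (chooseAbove-pascal-0 (∣ ∁ w ∣) (∣ w ∣))))))
count-supersets (suc k) (false ∷ w) (suc m) = trans (sum-subsets-suc k (IsSuperOfSize (false ∷ w) (suc m)))
  (trans (cong₂ _+_ (count-supersets k w m) (count-supersets k w (suc m)))
         (trans (sym (ι-+ (chooseAbove (∣ ∁ w ∣) (∣ w ∣) m) _)) (cong ι (sym (chooseAbove-pascal (∣ ∁ w ∣) (∣ w ∣) m)))))

sum-≡ˢ : ∀ k (u : Subset k) (F : Subset k → ℚ) → sumℚ (λ v → if u ≡ˢ v then F v else 0ℚ) (subsets k) ≡ F u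
sum-≡ˢ zero [] F = +-identityʳ (F [])
sum-≡ˢ (suc k) (true ∷ u) F = trans (sum-subsets-suc k (λ v → if (true ∷ u) ≡ˢ v then F v else 0ℚ))
  (trans (cong₂ _+_ (sum-≡ˢ k u (λ v → F (true ∷ v))) (sum-0 (subsets k))) (+-identityʳ _))
sum-≡ˢ (suc k) (false ∷ u) F = trans (sum-subsets-suc k (λ v → if (false ∷ u) ≡ˢ v then F v else 0ℚ))
  (trans (cong₂ _+_ (sum-0 (subsets k)) (sum-≡ˢ k u (λ v → F (false ∷ v)))) (+-identityˡ _))

-- For m-sets u, v (m = M+1) the number of
-- M-sets inside u ∩ v is C(|u∩v|, M), which is 1 if u ~ v (|u∩v| = M),
-- m if u = v and 0 otherwise.  Dually, for M-sets s, t the number of m-sets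
-- containing s ∪ t is 1 if s ~ t, n - M if s = t and 0 otherwise.  Both are
-- stated for the sizes j = |u ∩ v| and a = |s ∪ t| alone.

choose-intersection : ∀ M j (e : Bool) → (e ≡ true → j ≡ suc M) → (e ≡ false → j ≢ suc M) → j ℕ.≤ suc M →
   ι (choose j M) ≡ (if suc j ≡ᵇ suc M then 1ℚ else 0ℚ) + (if e then ι (suc M) else 0ℚ)
choose-intersection M j true equal _ _ with equal refl
... | refl = trans (cong ι (choose-1+ M))
   (sym (trans (cong (λ b → (if b then 1ℚ else 0ℚ) + ι (suc M)) (≡ᵇ-false {suc M} {M} ℕP.1+n≢n)) (+-identityˡ _)))
choose-intersection M j false _ distinct j≤ with ℕP.m≤n⇒m<n∨m≡n (ℕ.s≤s⁻¹ (ℕP.≤∧≢⇒< j≤ (distinct refl)))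
... | inj₂ refl rewrite choose-diag j | ≡ᵇ-refl j = refl
... | inj₁ j<M rewrite choose-> j M j<M | ≡ᵇ-false (ℕP.<⇒≢ j<M) = sym (+-identityˡ 0ℚ)

chooseAbove-union : ∀ M j a r (e : Bool) → a ℕ.+ j ≡ M ℕ.+ M → j ℕ.≤ M → (e ≡ true → j ≡ M) → (e ≡ false → j ≢ M) →
   ι (chooseAbove r a (suc M)) ≡ (if suc j ≡ᵇ M then 1ℚ else 0ℚ) + (if e then ι r else 0ℚ)
chooseAbove-union M j a r true sizes _ equal _ with equal refl
... | refl with ℕP.+-cancelʳ-≡ j a j sizes
...   | refl = trans (cong ι (chooseAbove-1+ r j))
   (sym (trans (cong (λ b → (if b then 1ℚ else 0ℚ) + ι r) (≡ᵇ-false {suc j} {j} ℕP.1+n≢n)) (+-identityˡ _)))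
chooseAbove-union M j a r false sizes j≤ _ distinct with ℕP.m≤n⇒m<n∨m≡n (ℕP.≤∧≢⇒< j≤ (distinct refl))
... | inj₂ refl with ℕP.+-cancelʳ-≡ j a (suc (suc j)) (trans sizes (ℕP.+-suc (suc j) j))
...   | refl rewrite ≡ᵇ-refl j = cong ι (trans (cong (chooseAbove r j) (sym (ℕP.+-identityʳ j))) (chooseAbove-+ r j 0))
chooseAbove-union M j a r false sizes j≤ _ distinct | inj₁ j<M with suc M ℕP.<? a
... | yes big rewrite chooseAbove-< r a (suc M) big | ≡ᵇ-false (ℕP.<⇒≢ j<M) = sym (+-identityˡ 0ℚ)
... | no small = ⊥-elim (ℕP.<-irrefl sizes (ℕP.≤-<-trans (ℕP.+-monoˡ-≤ j (ℕP.≮⇒≥ small))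
         (subst (ℕ._< M ℕ.+ M) (ℕP.+-suc M j) (ℕP.+-monoʳ-< M j<M))))

if-weight : (a e : Bool) (F c : ℚ) → F * ((if a then 1ℚ else 0ℚ) + (if e then c else 0ℚ)) ≡ (if a then F else 0ℚ) + (if e then c * F else 0ℚ)
if-weight true true F c = solve 2 (λ F c → F :* (con 1ℚ :+ c) := F :+ c :* F) refl F c
if-weight true false F c = solve 1 (λ F → F :* (con 1ℚ :+ con 0ℚ) := F :+ con 0ℚ) refl F
if-weight false true F c = solve 2 (λ F c → F :* (con 0ℚ :+ c) := con 0ℚ :+ c :* F) refl F c
if-weight false false F c = solve 1 (λ F → F :* (con 0ℚ :+ con 0ℚ) := con 0ℚ :+ con 0ℚ) refl F

module Johnson (n : ℕ) where

  layer : ℕ → List (Subset n)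
  layer m = filter (λ p → ∣ p ∣ ℕ.≟ m) (subsets n)

  adjJ : ℕ → Subset n → Subset n → Bool
  adjJ m p q = suc ∣ p ∩ q ∣ ≡ᵇ m

  size-in-layer : ∀ m {p} → p ∈ layer m → ∣ p ∣ ≡ m
  size-in-layer m mem = proj₂ (∈-filter⁻ (λ p → ∣ p ∣ ℕ.≟ m) {xs = subsets n} mem)

  ∈-layer : ∀ m p → ∣ p ∣ ≡ m → p ∈ layer m
  ∈-layer m p e = ∈-filter⁺ (λ p → ∣ p ∣ ℕ.≟ m) (∈-subsets n p) e

  sum-layer : ∀ m (F : Subset n → ℚ) → sumℚ F (layer m) ≡ sumℚ (λ p → if ∣ p ∣ ≡ᵇ m then F p else 0ℚ) (subsets n)
  sum-layer m F = sum-filter (λ p → ∣ p ∣ ℕ.≟ m) F (subsets n)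

  sum-layer-≡ˢ : ∀ m (u : Subset n) → ∣ u ∣ ≡ m → (F : Subset n → ℚ) → sumℚ (λ v → if u ≡ˢ v then F v else 0ℚ) (layer m) ≡ F u
  sum-layer-≡ˢ m u eu F = trans (sum-layer m (λ v → if u ≡ˢ v then F v else 0ℚ)) (trans (sum-cong (subsets n) drop-size) (sum-≡ˢ n u F))
    where
    drop-size : ∀ v → v ∈ subsets n → (if ∣ v ∣ ≡ᵇ m then (if u ≡ˢ v then F v else 0ℚ) else 0ℚ) ≡ (if u ≡ˢ v then F v else 0ℚ)
    drop-size v _ with u ≡ˢ v in eq
    ... | false = if-0 (∣ v ∣ ≡ᵇ m)
    ... | true with ≡ˢ-sound u v eq
    ...   | refl rewrite eu | ≡ᵇ-refl m = refl

  common-subsets : ∀ M (u v : Subset n) → ∣ u ∣ ≡ suc M → ∣ v ∣ ≡ suc M →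
    sumℚ (λ s → if (s ⊆ᵇ u) ∧ (s ⊆ᵇ v) then 1ℚ else 0ℚ) (layer M)
      ≡ (if adjJ (suc M) u v then 1ℚ else 0ℚ) + (if u ≡ˢ v then ι (suc M) else 0ℚ)
  common-subsets M u v eu ev = begin
    sumℚ (λ s → if (s ⊆ᵇ u) ∧ (s ⊆ᵇ v) then 1ℚ else 0ℚ) (layer M)
      ≡⟨ sum-layer M (λ s → if (s ⊆ᵇ u) ∧ (s ⊆ᵇ v) then 1ℚ else 0ℚ) ⟩
    sumℚ (λ s → if ∣ s ∣ ≡ᵇ M then (if (s ⊆ᵇ u) ∧ (s ⊆ᵇ v) then 1ℚ else 0ℚ) else 0ℚ) (subsets n)
      ≡⟨ sum-cong (subsets n) (λ s _ → cong (λ z → if ∣ s ∣ ≡ᵇ M then (if z then 1ℚ else 0ℚ) else 0ℚ) (⊆ᵇ-∩ s u v)) ⟩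
    sumℚ (IsSubOfSize (u ∩ v) M) (subsets n)  ≡⟨ count-subsets n (u ∩ v) M ⟩
    ι (choose ∣ u ∩ v ∣ M)
      ≡⟨ choose-intersection M ∣ u ∩ v ∣ (u ≡ˢ v) equal distinct (subst (∣ u ∩ v ∣ ℕ.≤_) eu (∣p∩q∣≤∣p∣ u v)) ⟩
    (if adjJ (suc M) u v then 1ℚ else 0ℚ) + (if u ≡ˢ v then ι (suc M) else 0ℚ) ∎
    where
    open ≡-Reasoning
    equal = proj₁ (∩-size≡-iff-≡ˢ (suc M) u v eu ev)
    distinct = proj₂ (∩-size≡-iff-≡ˢ (suc M) u v eu ev)

  common-supersets : ∀ M (s t : Subset n) → ∣ s ∣ ≡ M → ∣ t ∣ ≡ M →
    sumℚ (λ u → if (s ⊆ᵇ u) ∧ (t ⊆ᵇ u) then 1ℚ else 0ℚ) (layer (suc M))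
      ≡ (if adjJ M s t then 1ℚ else 0ℚ) + (if s ≡ˢ t then ι ∣ ∁ t ∣ else 0ℚ)
  common-supersets M s t es et = begin
    sumℚ (λ u → if (s ⊆ᵇ u) ∧ (t ⊆ᵇ u) then 1ℚ else 0ℚ) (layer (suc M))
      ≡⟨ sum-layer (suc M) (λ u → if (s ⊆ᵇ u) ∧ (t ⊆ᵇ u) then 1ℚ else 0ℚ) ⟩
    sumℚ (λ u → if ∣ u ∣ ≡ᵇ suc M then (if (s ⊆ᵇ u) ∧ (t ⊆ᵇ u) then 1ℚ else 0ℚ) else 0ℚ) (subsets n)
      ≡⟨ sum-cong (subsets n) (λ u _ → cong (λ z → if ∣ u ∣ ≡ᵇ suc M then (if z then 1ℚ else 0ℚ) else 0ℚ) (∪-⊆ᵇ s t u)) ⟩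
    sumℚ (IsSuperOfSize (s ∪ t) (suc M)) (subsets n)  ≡⟨ count-supersets n (s ∪ t) (suc M) ⟩
    ι (chooseAbove (∣ ∁ (s ∪ t) ∣) (∣ s ∪ t ∣) (suc M))
      ≡⟨ chooseAbove-union M (∣ s ∩ t ∣) (∣ s ∪ t ∣) (∣ ∁ (s ∪ t) ∣) (s ≡ˢ t) sizes
           (subst (∣ s ∩ t ∣ ℕ.≤_) es (∣p∩q∣≤∣p∣ s t)) equal distinct ⟩
    (if adjJ M s t then 1ℚ else 0ℚ) + (if s ≡ˢ t then ι ∣ ∁ (s ∪ t) ∣ else 0ℚ)
      ≡⟨ cong ((if adjJ M s t then 1ℚ else 0ℚ) +_) complement ⟩
    (if adjJ M s t then 1ℚ else 0ℚ) + (if s ≡ˢ t then ι ∣ ∁ t ∣ else 0ℚ) ∎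
    where
    open ≡-Reasoning
    sizes : ∣ s ∪ t ∣ ℕ.+ ∣ s ∩ t ∣ ≡ M ℕ.+ M
    sizes = trans (∣∪∣+∣∩∣ s t) (cong₂ ℕ._+_ es et)
    equal = proj₁ (∩-size≡-iff-≡ˢ M s t es et)
    distinct = proj₂ (∩-size≡-iff-≡ˢ M s t es et)
    complement : (if s ≡ˢ t then ι ∣ ∁ (s ∪ t) ∣ else 0ℚ) ≡ (if s ≡ˢ t then ι ∣ ∁ t ∣ else 0ℚ)
    complement with s ≡ˢ t in eq
    ... | false = refl
    ... | true with ≡ˢ-sound s t eq
    ...   | refl = cong (λ z → ι ∣ ∁ z ∣) (∪-idem s)

  Adj : ℕ → (Subset n → ℚ) → Subset n → ℚ
  Adj m f u = sumℚ (λ v → if adjJ m u v then f v else 0ℚ) (layer m)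

  down : ℕ → (Subset n → ℚ) → Subset n → ℚ
  down m f s = sumℚ (λ v → if s ⊆ᵇ v then f v else 0ℚ) (layer m)

  up : ℕ → (Subset n → ℚ) → Subset n → ℚ
  up M h u = sumℚ (λ s → if s ⊆ᵇ u then h s else 0ℚ) (layer M)

  up-down : ∀ M (f : Subset n → ℚ) u → ∣ u ∣ ≡ suc M → up M (down (suc M) f) u ≡ Adj (suc M) f u + ι (suc M) * f u
  up-down M f u eu = begin
    up M (down m f) u ≡⟨ double-count (layer M) (layer m) (λ s → s ⊆ᵇ u) (λ s v → s ⊆ᵇ v) f ⟩
    sumℚ (λ v → f v * sumℚ (λ s → if (s ⊆ᵇ u) ∧ (s ⊆ᵇ v) then 1ℚ else 0ℚ) (layer M)) (layer m)
       ≡⟨ sum-cong (layer m) (λ v v∈ → cong (f v *_) (common-subsets M u v eu (size-in-layer m v∈))) ⟩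
    sumℚ (λ v → f v * ((if adjJ m u v then 1ℚ else 0ℚ) + (if u ≡ˢ v then ι m else 0ℚ))) (layer m)
       ≡⟨ sum-cong (layer m) (λ v _ → if-weight (adjJ m u v) (u ≡ˢ v) (f v) (ι m)) ⟩
    sumℚ (λ v → (if adjJ m u v then f v else 0ℚ) + (if u ≡ˢ v then ι m * f v else 0ℚ)) (layer m)
       ≡⟨ sum-+ (λ v → if adjJ m u v then f v else 0ℚ) (λ v → if u ≡ˢ v then ι m * f v else 0ℚ) (layer m) ⟩
    Adj m f u + sumℚ (λ v → if u ≡ˢ v then ι m * f v else 0ℚ) (layer m)
       ≡⟨ cong (Adj m f u +_) (sum-layer-≡ˢ m u eu (λ v → ι m * f v)) ⟩
    Adj m f u + ι m * f u ∎
    where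
    open ≡-Reasoning
    m = suc M

  down-up : ∀ M (h : Subset n → ℚ) s → ∣ s ∣ ≡ M → down (suc M) (up M h) s ≡ Adj M h s + ι ∣ ∁ s ∣ * h s
  down-up M h s es = begin
    down m (up M h) s ≡⟨ double-count (layer m) (layer M) (λ u → s ⊆ᵇ u) (λ u t → t ⊆ᵇ u) h ⟩
    sumℚ (λ t → h t * sumℚ (λ u → if (s ⊆ᵇ u) ∧ (t ⊆ᵇ u) then 1ℚ else 0ℚ) (layer m)) (layer M)
       ≡⟨ sum-cong (layer M) (λ t t∈ → cong (h t *_) (common-supersets M s t es (size-in-layer M t∈))) ⟩
    sumℚ (λ t → h t * ((if adjJ M s t then 1ℚ else 0ℚ) + (if s ≡ˢ t then ι ∣ ∁ t ∣ else 0ℚ))) (layer M)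
       ≡⟨ sum-cong (layer M) (λ t _ → if-weight (adjJ M s t) (s ≡ˢ t) (h t) (ι ∣ ∁ t ∣)) ⟩
    sumℚ (λ t → (if adjJ M s t then h t else 0ℚ) + (if s ≡ˢ t then ι ∣ ∁ t ∣ * h t else 0ℚ)) (layer M)
       ≡⟨ sum-+ (λ t → if adjJ M s t then h t else 0ℚ) (λ t → if s ≡ˢ t then ι ∣ ∁ t ∣ * h t else 0ℚ) (layer M) ⟩
    Adj M h s + sumℚ (λ t → if s ≡ˢ t then ι ∣ ∁ t ∣ * h t else 0ℚ) (layer M)
       ≡⟨ cong (Adj M h s +_) (sum-layer-≡ˢ M s es (λ t → ι ∣ ∁ t ∣ * h t)) ⟩
    Adj M h s + ι ∣ ∁ s ∣ * h s ∎
    where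
    open ≡-Reasoning
    m = suc M

  ι∣∁∣ : ∀ (s : Subset n) → ι ∣ ∁ s ∣ ≡ ι n - ι ∣ s ∣
  ι∣∁∣ s = begin
    ι ∣ ∁ s ∣                  ≡⟨ solve 2 (λ Z M → Z := (M :+ Z) :- M) refl (ι ∣ ∁ s ∣) (ι ∣ s ∣) ⟩
    (ι ∣ s ∣ + ι ∣ ∁ s ∣) - ι ∣ s ∣  ≡⟨ cong (_- ι ∣ s ∣) (trans (sym (ι-+ ∣ s ∣ ∣ ∁ s ∣)) (cong ι (∣p∣+∣∁p∣ s))) ⟩
    ι n - ι ∣ s ∣ ∎
    where open ≡-Reasoning

  K : ℕ → ℚ
  K m = ι m * (ι n - ι m)

  up-down-eigen : ∀ M θ f → Eigenvector (layer (suc M)) (adjJ (suc M)) θ f →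
    ∀ u → u ∈ layer (suc M) → up M (down (suc M) f) u ≡ (θ + ι (suc M)) * f u
  up-down-eigen M θ f eig u u∈ = trans (up-down M f u (size-in-layer _ u∈))
    (trans (cong (_+ ι (suc M) * f u) (eig u u∈)) (sym (*-distribʳ-+ (f u) θ (ι (suc M)))))

  down-eigenvector : ∀ M θ f → Eigenvector (layer (suc M)) (adjJ (suc M)) θ f →
    Eigenvector (layer M) (adjJ M) (θ + ι (suc M) - (ι n - ι M)) (down (suc M) f)
  down-eigenvector M θ f eig s s∈ = begin
     Adj M g s                    ≡⟨ solve 3 (λ A Z G → A := (A :+ Z :* G) :- Z :* G) refl (Adj M g s) Z (g s) ⟩
     (Adj M g s + Z * g s) - Z * g s  ≡⟨ cong (_- Z * g s) (sym (down-up M g s (size-in-layer M s∈))) ⟩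
     down (suc M) (up M g) s - Z * g s  ≡⟨ cong (_- Z * g s) down-up-g ⟩
     c * g s - Z * g s            ≡⟨ cong (λ z → c * g s - z * g s) (trans (ι∣∁∣ s) (cong (λ z → ι n - ι z) (size-in-layer M s∈))) ⟩
     c * g s - (ι n - ι M) * g s
       ≡⟨ solve 4 (λ c N M G → c :* G :- (N :- M) :* G := (c :- (N :- M)) :* G) refl c (ι n) (ι M) (g s) ⟩
     (c - (ι n - ι M)) * g s ∎
    where
    open ≡-Reasoning
    g = down (suc M) f
    Z = ι ∣ ∁ s ∣
    c = θ + ι (suc M)
    down-up-g : down (suc M) (up M g) s ≡ c * g s
    down-up-g = trans (sum-cong (layer (suc M)) (λ u u∈ → trans (cong (λ z → if s ⊆ᵇ u then z else 0ℚ) (up-down-eigen M θ f eig u u∈))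
                                                                   (if-* (s ⊆ᵇ u) c (f u))))
                      (sum-* c (λ u → if s ⊆ᵇ u then f u else 0ℚ) (layer (suc M)))

  gap-after-down : ∀ M θ → let θ' = θ + ι (suc M) - (ι n - ι M) in
    θ' ≡ K M ⊎ θ' + ι n ≤ K M → θ ≡ K (suc M) ⊎ θ + ι n ≤ K (suc M)
  gap-after-down M θ (inj₁ e) = inj₁ (begin
      θ ≡⟨ solve 3 (λ θ M N → θ := (θ :+ (con 1ℚ :+ M) :- (N :- M)) :- (con 1ℚ :+ M) :+ (N :- M)) refl θ (ι M) (ι n) ⟩
      θ + ι (suc M) - (ι n - ι M) - (1ℚ + ι M) + (ι n - ι M)  ≡⟨ cong (λ z → z - (1ℚ + ι M) + (ι n - ι M)) e ⟩
      K M - (1ℚ + ι M) + (ι n - ι M)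
        ≡⟨ solve 2 (λ M N → M :* (N :- M) :- (con 1ℚ :+ M) :+ (N :- M) := (con 1ℚ :+ M) :* (N :- (con 1ℚ :+ M))) refl (ι M) (ι n) ⟩
      K (suc M) ∎)
    where open ≡-Reasoning
  gap-after-down M θ (inj₂ le) = inj₂ (begin
      θ + ι n
        ≡⟨ solve 3 (λ θ M N → θ :+ N := (θ :+ (con 1ℚ :+ M) :- (N :- M) :+ N) :+ ((N :- M) :- (con 1ℚ :+ M))) refl θ (ι M) (ι n) ⟩
      (θ + ι (suc M) - (ι n - ι M) + ι n) + ((ι n - ι M) - (1ℚ + ι M))  ≤⟨ +-monoˡ-≤ ((ι n - ι M) - (1ℚ + ι M)) le ⟩
      K M + ((ι n - ι M) - (1ℚ + ι M))
        ≡⟨ solve 2 (λ M N → M :* (N :- M) :+ ((N :- M) :- (con 1ℚ :+ M)) := (con 1ℚ :+ M) :* (N :- (con 1ℚ :+ M))) refl (ι M) (ι n) ⟩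
      K (suc M) ∎)
    where open ≤-Reasoning

  -- If down f vanishes, up (down f) = 0 forces θ = -(M+1), which lies at
  -- least n below the valency (M+1)(n-M-1) when M + 1 ≤ n.
  gap-when-down-vanishes : ∀ M θ → suc M ℕ.≤ n → θ + ι (suc M) ≡ 0ℚ → θ + ι n ≤ K (suc M)
  gap-when-down-vanishes M θ m≤n θ+m≡0 with ℕP.m≤n⇒∃[o]m+o≡n m≤n
  ... | r , refl = begin
      θ + ι (suc M ℕ.+ r)             ≡⟨ cong (θ +_) (ι-+ (suc M) r) ⟩
      θ + (ι (suc M) + ι r)           ≡⟨ sym (+-assoc θ (ι (suc M)) (ι r)) ⟩
      (θ + ι (suc M)) + ι r           ≡⟨ cong (_+ ι r) θ+m≡0 ⟩
      0ℚ + ι r                        ≡⟨ +-identityˡ (ι r) ⟩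
      ι r                             ≤⟨ ≤-+-nonneg (ι r) (ι M * ι r) (subst (0ℚ ≤_) (ι-* M r) (ι-nonneg (M ℕ.* r))) ⟩
      ι r + ι M * ι r
        ≡⟨ solve 2 (λ M R → R :+ M :* R := (con 1ℚ :+ M) :* (((con 1ℚ :+ M) :+ R) :- (con 1ℚ :+ M))) refl (ι M) (ι r) ⟩
      ι (suc M) * ((ι (suc M) + ι r) - ι (suc M))  ≡⟨ cong (λ z → ι (suc M) * (z - ι (suc M))) (sym (ι-+ (suc M) r)) ⟩
      K (suc M) ∎
    where open ≤-Reasoning

  johnson-gap : ∀ m → m ℕ.≤ n → SpectralGap (layer m) (adjJ m) (K m) (ι n)
  johnson-gap zero _ θ (f , (x , x∈ , nz) , eig) =
    inj₁ (trans (cancel-≢0 θ (f x) (trans (sym (eig x x∈)) (sum-0 (layer 0))) nz) (sym (*-zeroˡ (ι n - ι 0))))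
  johnson-gap (suc M) m≤n θ (f , (x , x∈ , nz) , eig) with vanishes-or-not (layer M) (down (suc M) f)
  ... | inj₂ (s₀ , s₀∈ , g≢0) = gap-after-down M θ
        (johnson-gap M (ℕP.<⇒≤ m≤n) _ (down (suc M) f , (s₀ , s₀∈ , g≢0) , down-eigenvector M θ f eig))
  ... | inj₁ g≡0 = inj₂ (gap-when-down-vanishes M θ m≤n
        (cancel-≢0 (θ + ι (suc M)) (f x) (trans (sym (up-down-eigen M θ f eig x x∈)) up-zero) nz))
    where
    up-zero : up M (down (suc M) f) x ≡ 0ℚ
    up-zero = trans (sum-cong (layer M) (λ s s∈ → trans (cong (λ z → if s ⊆ᵇ x then z else 0ℚ) (g≡0 s s∈)) (if-0 (s ⊆ᵇ x))))
                    (sum-0 (layer M))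

  layer-size : ∀ m → sumℚ (λ _ → 1ℚ) (layer m) ≡ ι (choose n m)
  layer-size m = begin
    sumℚ (λ _ → 1ℚ) (layer m)  ≡⟨ sum-layer m (λ _ → 1ℚ) ⟩
    sumℚ (λ p → if ∣ p ∣ ≡ᵇ m then 1ℚ else 0ℚ) (subsets n)
      ≡⟨ sum-cong (subsets n) (λ p _ → cong (λ z → if ∣ p ∣ ≡ᵇ m then (if z then 1ℚ else 0ℚ) else 0ℚ) (sym (⊆ᵇ-⊤ p))) ⟩
    sumℚ (IsSubOfSize ⊤ m) (subsets n)  ≡⟨ count-subsets n ⊤ m ⟩
    ι (choose ∣ ⊤ {n} ∣ m)               ≡⟨ cong (λ z → ι (choose z m)) (∣⊤∣≡n n) ⟩
    ι (choose n m) ∎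
    where open ≡-Reasoning

  down-one : ∀ M s → s ∈ layer M → down (suc M) (λ _ → 1ℚ) s ≡ ι n - ι M
  down-one M s s∈ = begin
    down (suc M) (λ _ → 1ℚ) s                  ≡⟨ sum-layer (suc M) (λ v → if s ⊆ᵇ v then 1ℚ else 0ℚ) ⟩
    sumℚ (IsSuperOfSize s (suc M)) (subsets n)  ≡⟨ count-supersets n s (suc M) ⟩
    ι (chooseAbove (∣ ∁ s ∣) (∣ s ∣) (suc M))   ≡⟨ cong (λ z → ι (chooseAbove (∣ ∁ s ∣) z (suc M))) |s| ⟩
    ι (chooseAbove (∣ ∁ s ∣) M (suc M))         ≡⟨ cong ι (chooseAbove-1+ (∣ ∁ s ∣) M) ⟩
    ι ∣ ∁ s ∣                                   ≡⟨ ι∣∁∣ s ⟩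
    ι n - ι ∣ s ∣                               ≡⟨ cong (λ z → ι n - ι z) |s| ⟩
    ι n - ι M ∎
    where
    open ≡-Reasoning
    |s| = size-in-layer M s∈

  up-const : ∀ M (c : ℚ) u → up M (λ _ → c) u ≡ c * ι (choose ∣ u ∣ M)
  up-const M c u = begin
    up M (λ _ → c) u                                      ≡⟨ sum-cong (layer M) (λ s _ → trans (cong (λ z → if s ⊆ᵇ u then z else 0ℚ) (sym (*-identityʳ c))) (if-* (s ⊆ᵇ u) c 1ℚ)) ⟩
    sumℚ (λ s → c * (if s ⊆ᵇ u then 1ℚ else 0ℚ)) (layer M) ≡⟨ sum-* c _ (layer M) ⟩
    c * sumℚ (λ s → if s ⊆ᵇ u then 1ℚ else 0ℚ) (layer M)   ≡⟨ cong (c *_) (sum-layer M (λ s → if s ⊆ᵇ u then 1ℚ else 0ℚ)) ⟩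
    c * sumℚ (IsSubOfSize u M) (subsets n)                 ≡⟨ cong (c *_) (count-subsets n u M) ⟩
    c * ι (choose ∣ u ∣ M) ∎
    where open ≡-Reasoning

  -- J(n,M+1) is K(M+1)-regular, read off from  up ∘ down = A + (M+1)
  valency : ∀ M u → u ∈ layer (suc M) → Adj (suc M) (λ _ → 1ℚ) u ≡ K (suc M)
  valency M u u∈ = begin
    Adj (suc M) 𝟙 u
      ≡⟨ solve 2 (λ A m → A := (A :+ m :* con 1ℚ) :- m :* con 1ℚ) refl (Adj (suc M) 𝟙 u) (ι (suc M)) ⟩
    (Adj (suc M) 𝟙 u + ι (suc M) * 1ℚ) - ι (suc M) * 1ℚ  ≡⟨ cong (_- ι (suc M) * 1ℚ) (sym (up-down M 𝟙 u |u|)) ⟩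
    up M (down (suc M) 𝟙) u - ι (suc M) * 1ℚ               ≡⟨ cong (_- ι (suc M) * 1ℚ) up-down-one ⟩
    (ι n - ι M) * ι (suc M) - ι (suc M) * 1ℚ
      ≡⟨ solve 2 (λ N M → (N :- M) :* (con 1ℚ :+ M) :- (con 1ℚ :+ M) :* con 1ℚ := (con 1ℚ :+ M) :* (N :- (con 1ℚ :+ M))) refl (ι n) (ι M) ⟩
    K (suc M) ∎
    where
    open ≡-Reasoning
    𝟙 : Subset n → ℚ
    𝟙 _ = 1ℚ
    |u| = size-in-layer (suc M) u∈
    up-down-one : up M (down (suc M) 𝟙) u ≡ (ι n - ι M) * ι (suc M)
    up-down-one = begin
      up M (down (suc M) 𝟙) u
        ≡⟨ sum-cong (layer M) (λ s s∈ → cong (λ z → if s ⊆ᵇ u then z else 0ℚ) (down-one M s s∈)) ⟩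
      up M (λ _ → ι n - ι M) u                 ≡⟨ up-const M (ι n - ι M) u ⟩
      (ι n - ι M) * ι (choose ∣ u ∣ M)          ≡⟨ cong (λ z → (ι n - ι M) * ι (choose z M)) |u| ⟩
      (ι n - ι M) * ι (choose (suc M) M)        ≡⟨ cong (λ z → (ι n - ι M) * ι z) (choose-1+ M) ⟩
      (ι n - ι M) * ι (suc M) ∎

containsFirst : ∀ {k} → Subset (suc k) → Bool
containsFirst (b ∷ _) = b

module JohnsonTestSet (n' E : ℕ) (half : 2 ℕ.* suc E ℕ.≤ suc n') where

  n e : ℕ
  n = suc n'
  e = suc E

  open Johnson n
  module Rest = Johnson n'

  G : Graph
  G = johnson n e

  e≤n : e ℕ.≤ n
  e≤n = ℕP.≤-trans (ℕP.m≤m+n e (e ℕ.+ 0)) half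

  -- n' = E + e + t: the hypothesis 2e ≤ n one point down
  spare : Σ ℕ λ t → E ℕ.+ e ℕ.+ t ≡ n'
  spare = ℕP.m≤n⇒∃[o]m+o≡n (subst (ℕ._≤ n') (cong (E ℕ.+_) (ℕP.+-identityʳ e)) (ℕ.s≤s⁻¹ half))

  sum-containsFirst : ∀ (F : Subset n → ℚ) →
    sumℚ (λ x → if containsFirst x then F x else 0ℚ) (layer e) ≡ sumℚ (λ p → F (true ∷ p)) (Rest.layer E)
  sum-containsFirst F = trans (sum-layer e (λ x → if containsFirst x then F x else 0ℚ))
    (trans (sum-subsets-suc n' (λ x → if ∣ x ∣ ≡ᵇ e then (if containsFirst x then F x else 0ℚ) else 0ℚ))
    (trans (cong₂ _+_ (sym (Rest.sum-layer E (λ p → F (true ∷ p)))) (sum-zero (subsets n') _ (λ p → if-0 (∣ p ∣ ≡ᵇ e))))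
           (+-identityʳ _)))

  -- 0 ∪ p has n - e neighbours avoiding 0: the e-sets q ⊇ p of the other points
  outside : ∀ p → p ∈ Rest.layer E →
    ι (countL (λ y → not (containsFirst y) ∧ adj G (true ∷ p) y) (layer e)) ≡ ι n - ι e
  outside p p∈ = begin
      ι (countL (λ y → not (containsFirst y) ∧ adj G (true ∷ p) y) (layer e))
        ≡⟨ sym (sum-indicator (λ y → not (containsFirst y) ∧ adj G (true ∷ p) y) (layer e)) ⟩
      sumℚ (λ y → if not (containsFirst y) ∧ adj G (true ∷ p) y then 1ℚ else 0ℚ) (layer e)
        ≡⟨ sum-layer e (λ y → if not (containsFirst y) ∧ adj G (true ∷ p) y then 1ℚ else 0ℚ) ⟩
      sumℚ (λ y → if ∣ y ∣ ≡ᵇ e then (if not (containsFirst y) ∧ adj G (true ∷ p) y then 1ℚ else 0ℚ) else 0ℚ) (subsets n)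
        ≡⟨ sum-subsets-suc n' (λ y → if ∣ y ∣ ≡ᵇ e then (if not (containsFirst y) ∧ adj G (true ∷ p) y then 1ℚ else 0ℚ) else 0ℚ) ⟩
      sumℚ (λ q → if suc ∣ q ∣ ≡ᵇ e then 0ℚ else 0ℚ) (subsets n')
        + sumℚ (λ q → if ∣ q ∣ ≡ᵇ e then (if ∣ p ∩ q ∣ ≡ᵇ E then 1ℚ else 0ℚ) else 0ℚ) (subsets n')
        ≡⟨ cong₂ _+_ (sum-zero (subsets n') _ (λ q → if-0 (suc ∣ q ∣ ≡ᵇ e)))
             (sum-cong (subsets n') (λ q _ → cong (λ z → if ∣ q ∣ ≡ᵇ e then (if z then 1ℚ else 0ℚ) else 0ℚ)
               (trans (cong (∣ p ∩ q ∣ ≡ᵇ_) (sym |p|)) (∩-size-⊆ᵇ p q)))) ⟩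
      0ℚ + sumℚ (IsSuperOfSize p e) (subsets n')   ≡⟨ +-identityˡ _ ⟩
      sumℚ (IsSuperOfSize p e) (subsets n')        ≡⟨ count-supersets n' p e ⟩
      ι (chooseAbove (∣ ∁ p ∣) (∣ p ∣) e)          ≡⟨ cong (λ z → ι (chooseAbove (∣ ∁ p ∣) z e)) |p| ⟩
      ι (chooseAbove (∣ ∁ p ∣) E e)                ≡⟨ cong ι (chooseAbove-1+ (∣ ∁ p ∣) E) ⟩
      ι ∣ ∁ p ∣                                    ≡⟨ Rest.ι∣∁∣ p ⟩
      ι n' - ι ∣ p ∣                               ≡⟨ cong (λ z → ι n' - ι z) |p| ⟩
      ι n' - ι E                                   ≡⟨ solve 2 (λ a b → a :- b := (con 1ℚ :+ a) :- (con 1ℚ :+ b)) refl (ι n') (ι E) ⟩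
      ι n - ι e ∎
    where
    open ≡-Reasoning
    |p| = Rest.size-in-layer E p∈

  |S| : ι (card G containsFirst) ≡ ι (choose n' E)
  |S| = trans (sym (sum-indicator containsFirst (layer e))) (trans (sum-containsFirst (λ _ → 1ℚ)) (Rest.layer-size E))

  |V| : ι (length (layer e)) ≡ ι (choose n' E) + ι (choose n' e)
  |V| = trans (ι-length (layer e)) (trans (sum-layer e (λ _ → 1ℚ))
     (trans (sum-subsets-suc n' (λ x → if ∣ x ∣ ≡ᵇ e then 1ℚ else 0ℚ))
            (cong₂ _+_ (trans (sym (Rest.sum-layer E (λ _ → 1ℚ))) (Rest.layer-size E))
                       (trans (sym (Rest.sum-layer e (λ _ → 1ℚ))) (Rest.layer-size e)))))

  -- C(n', E) ≤ C(n', E+1) when 2E + 1 ≤ n', by absorption: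
  -- C(n',E+1)·(E+1) = C(n',E)·(n' - E) ≥ C(n',E)·(E+1)
  choose-middle : ι (choose n' E) ≤ ι (choose n' e)
  choose-middle with spare
  ... | t , n'≡ = *-cancelʳ-≤-pos (ι e) (begin
       c₀ * ι e                            ≤⟨ ≤-+-nonneg (c₀ * ι e) (c₀ * ι t) (subst (0ℚ ≤_) (ι-* (choose n' E) t) (ι-nonneg (choose n' E ℕ.* t))) ⟩
       c₀ * ι e + c₀ * ι t
         ≡⟨ solve 3 (λ c₀ Eq T → c₀ :* (con 1ℚ :+ Eq) :+ c₀ :* T := c₀ :* ((Eq :+ (con 1ℚ :+ Eq)) :+ T) :- c₀ :* Eq) refl c₀ (ι E) (ι t) ⟩
       c₀ * ((ι E + ι e) + ι t) - c₀ * ι E   ≡⟨ cong (λ z → c₀ * z - c₀ * ι E) total ⟩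
       c₀ * ι n' - c₀ * ι E                  ≡⟨ cong (_- c₀ * ι E) (sym (choose-absorb n' E)) ⟩
       (c₁ * ι e + c₀ * ι E) - c₀ * ι E       ≡⟨ solve 3 (λ c₁ e X → (c₁ :* e :+ X) :- X := c₁ :* e) refl c₁ (ι e) (c₀ * ι E) ⟩
       c₁ * ι e ∎)
    where
    open ≤-Reasoning
    c₀ = ι (choose n' E)
    c₁ = ι (choose n' e)
    instance
      pe : Positive (ι e)
      pe = positive (ι-pos E)
    total : (ι E + ι e) + ι t ≡ ι n'
    total = trans (cong (_+ ι t) (sym (ι-+ E e))) (trans (sym (ι-+ (E ℕ.+ e) t)) (cong ι n'≡))

  x₀ : Subset n
  x₀ = true ∷ proj₁ (subset-of-size n' E (ℕP.≤-trans (ℕP.m≤m+n E (e ℕ.+ proj₁ spare))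
         (ℕP.≤-reflexive (trans (sym (ℕP.+-assoc E e (proj₁ spare))) (proj₂ spare)))))

  x₀∈ : x₀ ∈ layer e
  x₀∈ = ∈-layer e x₀ (cong suc (proj₂ (subset-of-size n' E _)))

  admissible : Admissible G containsFirst
  admissible = (x₀ , x₀∈ , refl) , ι-reflect (begin
      ι (2 ℕ.* card G containsFirst)   ≡⟨ ι-* 2 (card G containsFirst) ⟩
      ι 2 * ι (card G containsFirst)   ≡⟨ cong (ι 2 *_) |S| ⟩
      ι 2 * c₀                          ≡⟨ solve 1 (λ c₀ → (con 1ℚ :+ (con 1ℚ :+ con 0ℚ)) :* c₀ := c₀ :+ c₀) refl c₀ ⟩
      c₀ + c₀                            ≤⟨ +-monoʳ-≤ c₀ choose-middle ⟩
      c₀ + ι (choose n' e)              ≡⟨ sym |V| ⟩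
      ι (length (verts G)) ∎)
    where
    open ≤-Reasoning
    c₀ = ι (choose n' E)

  ∂S : ι (edgeBoundary G containsFirst) ≡ ι (card G containsFirst) * (ι n - ι e)
  ∂S = boundary-uniform G containsFirst (ι n - ι e) out
    where
    out : ∀ x → x ∈ verts G → containsFirst x ≡ true →
          ι (countL (λ y → not (containsFirst y) ∧ adj G x y) (verts G)) ≡ ι n - ι e
    out (true ∷ p) x∈ _ = outside p (Rest.∈-layer E p (ℕP.suc-injective (size-in-layer e x∈)))

johnson-cheeger : ∀ n' E → (half : 2 ℕ.* suc E ℕ.≤ suc n') → (k : ℕ) → Regular (johnson (suc n') (suc E)) k
  → (θ₁ : ℚ) → SecondLargestEigenvalue (johnson (suc n') (suc E)) θ₁
  → (h : ℚ) → IsCheegerConstant (johnson (suc n') (suc E)) h → h ≤ lambda1 θ₁ k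
johnson-cheeger n' E half k reg θ₁ second h cheeger =
  cheeger-via-test-set G k reg containsFirst admissible (ι n - ι e) θ₁ ∂S (≤-trans n-e≤n gap) h cheeger
  where
  open JohnsonTestSet n' E half
  open Johnson n using (K; valency; johnson-gap)
  k≡K : ι k ≡ K e
  k≡K = trans (cong ι (sym (reg x₀ x₀∈))) (trans (sym (sum-indicator _ (verts G))) (valency E x₀ x₀∈))
  gap : ι n ≤ ι k - θ₁
  gap = subst (λ K → ι n ≤ K - θ₁) (sym k≡K) (gap-bounds-θ₁ G (K e) (ι n) θ₁ (ι-nonneg n) (johnson-gap e e≤n) second)
  n-e≤n : ι n - ι e ≤ ι n
  n-e≤n = subst (ι n - ι e ≤_) (solve 2 (λ a b → a :- b :+ b := a) refl (ι n) (ι e)) (≤-+-nonneg (ι n - ι e) (ι e) (ι-nonneg e))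

mainTheorem2 : (G : Graph)
    → ((Σ ℕ λ n → Σ ℕ λ e → 1 ℕ.≤ e × 2 ℕ.* e ℕ.≤ n × G ≡ johnson n e)
       ⊎ (Σ ℕ λ d → Σ ℕ λ q → 1 ℕ.≤ d × 2 ℕ.≤ q × G ≡ hamming d q))
    → (k : ℕ) → Regular G k
    → (θ₁ : ℚ) → SecondLargestEigenvalue G θ₁
    → (h : ℚ) → IsCheegerConstant G h
    → h ≤ lambda1 θ₁ k
mainTheorem2 G (inj₁ (suc n' , suc E , _ , half , refl)) = johnson-cheeger n' E half
mainTheorem2 G (inj₂ (suc d , suc q' , _ , ℕ.s≤s 1≤q' , refl)) = Hamming.hamming-cheeger q' d 1≤q'
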